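{- Let $k\ge 2$, $D$ and $m$ be positive integers. Let $G$ be an $n$-vertex graph satisfying $\delta(G)\ge 9k^2$, $\Delta(G)\le D$ and $g(G)\ge 2m+2$. Let $B\subseteq V(G)$ satisfy $|B|\ge n/D$. Assume that $2(k^2-1)^m\ge 11k^2D^2$. Then $G$ contains a $k$-connected induced subgraph $H$ with $|V(H)|\ge 11k^2D^2$ such that \[\bigl|\{x\in B\cap V(H): d_H(x)\ge d_G(x)-2k^2\}\bigr|\ge \frac{|V(H)|}{2D}\ge \frac{11}{2}k^2D.\]
   Context: All graphs are finite and simple. $\delta(G)$, $\Delta(G)$, $g(G)$ denote minimum degree, maximum degree, and girth (length of a shortest cycle; infinite if there is none). $d_H(x)$ denotes the degree of $x$ in $H$. -}

module Defs where

open import Data.Nat using (ℕ; zero; suc; _+_; _*_; _≤_; _<_; _≤ᵇ_)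
open import Data.Bool using (Bool; true; false; _∧_)
open import Data.Fin using (Fin; toℕ)
open import Data.Fin.Subset using (Subset; _∈_; _∉_; _⊆_; _∩_; ∁; ∣_∣)
open import Data.Vec using (tabulate; lookup)
open import Data.Product using (Σ; _×_; _,_)
open import Relation.Binary.PropositionalEquality using (_≡_)

record Graph (n : ℕ) : Set where
  field
    adj    : Fin n → Fin n → Bool
    sym    : ∀ x y → adj x y ≡ adj y x
    irrefl : ∀ x → adj x x ≡ false

open Graph public

Adj : ∀ {n} → Graph n → Fin n → Fin n → Set
Adj G x y = adj G x y ≡ true

N : ∀ {n} → Graph n → Fin n → Subset n
N G x = tabulate (adj G x)

deg : ∀ {n} → Graph n → Fin n → ℕ
deg G x = ∣ N G x ∣

-- d_H(x) where H = G[S] is the subgraph induced by S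
degIn : ∀ {n} → Graph n → Subset n → Fin n → ℕ
degIn G S x = ∣ N G x ∩ S ∣

MinDeg≥ : ∀ {n} → Graph n → ℕ → Set
MinDeg≥ G d = ∀ x → d ≤ deg G x

MaxDeg≤ : ∀ {n} → Graph n → ℕ → Set
MaxDeg≤ G D = ∀ x → deg G x ≤ D

record Cycle {n} (G : Graph n) (l : ℕ) : Set where
  field
    vert  : Fin l → Fin n
    inj   : ∀ i j → vert i ≡ vert j → i ≡ j
    long  : 3 ≤ l
    step  : ∀ i j → toℕ j ≡ suc (toℕ i) → Adj G (vert i) (vert j)
    close : ∀ i j → toℕ i ≡ 0 → suc (toℕ j) ≡ l → Adj G (vert j) (vert i)

-- g(G) ≥ g : every cycle has length at least g (vacuous if acyclic)
Girth≥ : ∀ {n} → Graph n → ℕ → Set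
Girth≥ G g = ∀ l → Cycle G l → g ≤ l

data Walk {n} (G : Graph n) (T : Subset n) : Fin n → Fin n → Set where
  here : ∀ {u} → Walk G T u u
  next : ∀ {u w v} → Adj G u w → w ∈ T → Walk G T w v → Walk G T u v

Connected : ∀ {n} → Graph n → Subset n → Set
Connected G T = ∀ u v → u ∈ T → v ∈ T → Walk G T u v

KConnected : ∀ {n} → Graph n → ℕ → Subset n → Set
KConnected G k S =
  (k < ∣ S ∣) × (∀ X → X ⊆ S → ∣ X ∣ < k → Connected G (S ∩ ∁ X))

-- { x ∈ B ∩ V(H) : d_H(x) ≥ d_G(x) - c }  where H = G[S]
-- (d_H(x) ≥ d_G(x) - c written as d_G(x) ≤ d_H(x) + c)
GoodSet : ∀ {n} → Graph n → Subset n → Subset n → ℕ → Subset n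
GoodSet G B S c =
  tabulate (λ x → lookup B x ∧ lookup S x ∧ (deg G x ≤ᵇ degIn G S x + c))

-- Call a vertex set S a candidate if G[S] has minimum degree at least K = k² and the potential
-- 4DK·|B ∩ S| − 3K·|S| − 2D·e(S, V ∖ S) of S is at least −C, where C = k(3K + 2D²); V(G) is a
-- candidate because n ≤ D·|B|. Deleting a vertex with fewer than 2K neighbours in S raises the
-- potential, since its degree is at least 9K and so e(S, V ∖ S) drops by more than 5K. By the
-- Moore bound for girth 2m + 2 every candidate has at least 2(K − 1)^m ≥ 11KD² > C vertices, so
-- such deletions can never empty a candidate. If G[S] is not k-connected, a separator X with
-- |X| < k splits S into two sides meeting in X whose potentials add up to at least that of S
-- minus C. Peel both sides down to their K-cores. If one core is empty, that side can be peeled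
-- off S altogether at threshold K + |X| ≤ 2K, so the other core is a candidate; otherwise
-- counting potentials shows that one of the cores is. Either way S shrinks, so the process stops
-- at a k-connected candidate. There every vertex of B ∩ S that is not good has more than 2K
-- edges leaving S, and the potential bound together with C ≤ K·|S| gives |S| ≤ 2D·#good.

module Submission where

import Data.Bool
open Data.Bool using (Bool; true; false; _∧_; _∨_; not)
import Data.Bool.Properties as B
open import Data.Empty using (⊥; ⊥-elim)
open import Data.Fin using (Fin; zero; suc; toℕ; fromℕ<; inject≤; punchIn; remQuot; combine)
open import Data.Fin.Properties
  using (_≟_; any?; injective⇒≤; toℕ<n; toℕ-injective; toℕ-fromℕ<; inject≤-injective;
         punchInᵢ≢i; punchIn-injective; combine-remQuot)
  renaming (suc-injective to fsuc-injective)
import Data.Fin.Subset as Sub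
open Sub using (Subset; ∣_∣)
open import Data.Fin.Subset.Properties using (anySubset?; _⊆?_)
open import Data.Nat using (ℕ; zero; suc; _+_; _*_; _^_; _∸_; _≤_; _<_; _≤ᵇ_; z≤n; s≤s; _≤?_; _<?_; >-nonZero)
open import Data.Nat.Induction using (<-wellFounded)
open import Data.Nat.Properties hiding (_≟_)
open import Data.Nat.Tactic.RingSolver using (solve-∀)
open import Data.Product using (Σ; ∃; _×_; _,_; proj₁; proj₂; uncurry)
open import Data.Sum using (_⊎_; inj₁; inj₂)
open import Data.Vec using (Vec; []; _∷_; lookup; tabulate)
open import Data.Vec.Properties using ([]=⇒lookup; lookup⇒[]=; ∷-injective; lookup∘tabulate; lookup-zipWith; lookup-map)
open import Function using (_∘_)
open import Function.Definitions using (Injective)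
open import Induction.WellFounded using (Acc; acc)
open import Relation.Binary.PropositionalEquality
open import Relation.Nullary using (¬_; Dec; yes; no; does; _×-dec_)
open import Relation.Nullary.Decidable using (dec-true)
open import Algebra.Properties.CommutativeSemigroup +-commutativeSemigroup using (interchange)
open import Algebra.Properties.Semiring.Sum +-*-semiring
  using (sum; sum-cong-≗; ∑-distrib-+; *-distribˡ-sum; sum-replicate-zero)

open import Defs hiding (sym; irrefl)

-- Vertex sets are Boolean functions on Fin n, so that pointwise facts follow by case analysis;
-- the Subset n of the statement is reached through lookup and tabulate.

BSet : ℕ → Set
BSet n = Fin n → Bool

module _ {n : ℕ} where

  infixr 7 _∩_
  infixl 6 _∖_
  infixr 5 _∪_
  infix 4 _≐_ _⊆_

  _∩_ _∪_ _∖_ : BSet n → BSet n → BSet n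
  (P ∩ Q) x = P x ∧ Q x
  (P ∪ Q) x = P x ∨ Q x
  (P ∖ Q) x = P x ∧ not (Q x)

  ⁅_⁆ : Fin n → BSet n
  ⁅ x ⁆ y = does (y ≟ x)

  _≐_ : BSet n → BSet n → Set
  P ≐ Q = ∀ x → P x ≡ Q x

  _⊆_ : BSet n → BSet n → Set
  P ⊆ Q = ∀ x → P x ≡ true → Q x ≡ true

  Empty : BSet n → Set
  Empty P = ∀ x → P x ≡ false

true≢false : true ≢ false
true≢false ()

χ : Bool → ℕ
χ true  = 1
χ false = 0

χ≤1 : ∀ b → χ b ≤ 1
χ≤1 true  = ≤-refl
χ≤1 false = z≤n

count : ∀ {n} → BSet n → ℕ
count P = sum (χ ∘ P)

sum-mono-≤ : ∀ {n} {f g : Fin n → ℕ} → (∀ i → f i ≤ g i) → sum f ≤ sum g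
sum-mono-≤ {zero}  f≤g = z≤n
sum-mono-≤ {suc n} f≤g = +-mono-≤ (f≤g zero) (sum-mono-≤ (f≤g ∘ suc))

sum-⁅⁆ : ∀ {n} (x : Fin n) (f : Fin n → ℕ) → sum (λ i → χ (⁅ x ⁆ i) * f i) ≡ f x
sum-⁅⁆ {suc n} zero f = begin
  f zero + 0 + sum {n} (λ _ → 0) ≡⟨ cong₂ _+_ (+-identityʳ (f zero)) (sum-replicate-zero n) ⟩
  f zero + 0                     ≡⟨ +-identityʳ (f zero) ⟩
  f zero                         ∎
  where open ≡-Reasoning
sum-⁅⁆ {suc n} (suc x) f = trans (sum-cong-≗ χ⁅x⁆f) (sum-⁅⁆ x (f ∘ suc))
  where
  χ⁅x⁆f : ∀ i → χ (⁅ suc x ⁆ (suc i)) * f (suc i) ≡ χ (⁅ x ⁆ i) * f (suc i)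
  χ⁅x⁆f i with i ≟ x
  ... | yes _ = refl
  ... | no  _ = refl

count-≐ : ∀ {n} {P Q : BSet n} → P ≐ Q → count P ≡ count Q
count-≐ P≐Q = sum-cong-≗ (cong χ ∘ P≐Q)

count-mono : ∀ {n} {P Q : BSet n} → P ⊆ Q → count P ≤ count Q
count-mono {P = P} {Q} P⊆Q = sum-mono-≤ χP≤χQ
  where
  χP≤χQ : ∀ i → χ (P i) ≤ χ (Q i)
  χP≤χQ i with P i in Pi
  ... | true  rewrite P⊆Q i Pi = ≤-refl
  ... | false = z≤n

count-≤ : ∀ {n} (P : BSet n) → count P ≤ n
count-≤ {zero}  P = z≤n
count-≤ {suc n} P = +-mono-≤ (χ≤1 (P zero)) (count-≤ (P ∘ suc))

count-empty : ∀ {n} {P : BSet n} → Empty P → count P ≡ 0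
count-empty {n} P-empty = trans (sum-cong-≗ (cong χ ∘ P-empty)) (sum-replicate-zero n)

count-full : ∀ n → count {n} (λ _ → true) ≡ n
count-full zero    = refl
count-full (suc n) = cong suc (count-full n)

count-split : ∀ {n} (P Q : BSet n) → count P ≡ count (P ∩ Q) + count (P ∖ Q)
count-split P Q = trans (sum-cong-≗ χ-split) (∑-distrib-+ (χ ∘ (P ∩ Q)) (χ ∘ (P ∖ Q)))
  where
  χ-split : ∀ i → χ (P i) ≡ χ ((P ∩ Q) i) + χ ((P ∖ Q) i)
  χ-split i with P i | Q i
  ... | true  | true  = refl
  ... | true  | false = refl
  ... | false | _     = refl

count-∩⁅⁆ : ∀ {n} (P : BSet n) x → count (P ∩ ⁅ x ⁆) ≡ χ (P x)
count-∩⁅⁆ P x = trans (sum-cong-≗ χ-∩⁅x⁆) (sum-⁅⁆ x (χ ∘ P))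
  where
  χ-∩⁅x⁆ : ∀ i → χ (P i ∧ ⁅ x ⁆ i) ≡ χ (⁅ x ⁆ i) * χ (P i)
  χ-∩⁅x⁆ i with P i | ⁅ x ⁆ i
  ... | true  | true  = refl
  ... | true  | false = refl
  ... | false | true  = refl
  ... | false | false = refl

count-∖⁅⁆ : ∀ {n} (P : BSet n) x → count P ≡ χ (P x) + count (P ∖ ⁅ x ⁆)
count-∖⁅⁆ P x = trans (count-split P ⁅ x ⁆) (cong (_+ count (P ∖ ⁅ x ⁆)) (count-∩⁅⁆ P x))

count-remove : ∀ {n} (P : BSet n) x → P x ≡ true → count P ≡ suc (count (P ∖ ⁅ x ⁆))
count-remove P x Px = trans (count-∖⁅⁆ P x) (cong (λ b → χ b + count (P ∖ ⁅ x ⁆)) Px)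

count-⊂ : ∀ {n} {P Q : BSet n} x → P ⊆ Q → Q x ≡ true → P x ≡ false → count P < count Q
count-⊂ {P = P} {Q} x P⊆Q Qx Px = begin-strict
  count P               ≤⟨ count-mono P⊆Q∖x ⟩
  count (Q ∖ ⁅ x ⁆)     <⟨ n<1+n _ ⟩
  suc (count (Q ∖ ⁅ x ⁆)) ≡⟨ sym (count-remove Q x Qx) ⟩
  count Q               ∎
  where
  open ≤-Reasoning
  P⊆Q∖x : P ⊆ Q ∖ ⁅ x ⁆
  P⊆Q∖x y Py with y ≟ x
  ... | yes refl = ⊥-elim (true≢false (trans (sym Py) Px))
  ... | no  _    = trans (B.∧-identityʳ (Q y)) (P⊆Q y Py)

∣∣≡count : ∀ {n} (p : Subset n) → ∣ p ∣ ≡ count (lookup p)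
∣∣≡count []          = refl
∣∣≡count (true  ∷ p) = cong suc (∣∣≡count p)
∣∣≡count (false ∷ p) = ∣∣≡count p

∣tabulate∣≡count : ∀ {n} (P : BSet n) → ∣ tabulate P ∣ ≡ count P
∣tabulate∣≡count P = trans (∣∣≡count (tabulate P)) (count-≐ (lookup∘tabulate P))

count-insert : ∀ {n} (P : BSet n) x → P x ≡ false → count (P ∪ ⁅ x ⁆) ≡ suc (count P)
count-insert P x Px =
  trans (count-remove (P ∪ ⁅ x ⁆) x (trans x∈⁅x⁆ (B.∨-zeroʳ (P x)))) (cong suc (count-≐ unchanged))
  where
  x∈⁅x⁆ : P x ∨ ⁅ x ⁆ x ≡ P x ∨ true
  x∈⁅x⁆ = cong (P x ∨_) (dec-true (x ≟ x) refl)
  unchanged : (P ∪ ⁅ x ⁆) ∖ ⁅ x ⁆ ≐ P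
  unchanged y with y ≟ x
  ... | yes refl rewrite Px = refl
  ... | no _ = trans (B.∧-identityʳ _) (B.∨-identityʳ (P y))

module _ where
  private
    cons : ∀ {n} b {c} → (Fin c → Fin n) → Fin (χ b + c) → Fin (suc n)
    cons true  f zero    = zero
    cons true  f (suc i) = suc (f i)
    cons false f i       = suc (f i)

    skip : ∀ b {c} → Fin c → Fin (χ b + c)
    skip true  i = suc i
    skip false i = i

    skip-injective : ∀ b {c} {i j : Fin c} → skip b i ≡ skip b j → i ≡ j
    skip-injective true  = fsuc-injective
    skip-injective false eq = eq

    first : ∀ b {c} → b ≡ true → Fin (χ b + c)
    first true refl = zero

    first≢skip : ∀ b {c} (b≡true : b ≡ true) (i : Fin c) → first b b≡true ≢ skip b i
    first≢skip true refl i ()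

  enum : ∀ {n} (P : BSet n) → Fin (count P) → Fin n
  enum {suc n} P = cons (P zero) (enum (P ∘ suc))

  enum-∈ : ∀ {n} (P : BSet n) i → P (enum P i) ≡ true
  enum-∈ {suc n} P i with P zero in P0
  enum-∈ {suc n} P zero    | true  = P0
  enum-∈ {suc n} P (suc i) | true  = enum-∈ (P ∘ suc) i
  enum-∈ {suc n} P i       | false = enum-∈ (P ∘ suc) i

  enum-injective : ∀ {n} (P : BSet n) {i j} → enum P i ≡ enum P j → i ≡ j
  enum-injective {suc n} P {i} {j} eq with P zero
  enum-injective {suc n} P {zero}  {zero}  eq | true  = refl
  enum-injective {suc n} P {suc i} {suc j} eq | true  = cong suc (enum-injective (P ∘ suc) (fsuc-injective eq))
  enum-injective {suc n} P {i}     {j}     eq | false = enum-injective (P ∘ suc) (fsuc-injective eq)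

  index : ∀ {n} (P : BSet n) x → P x ≡ true → Fin (count P)
  index {suc n} P zero    P0 = first (P zero) P0
  index {suc n} P (suc x) Px = skip (P zero) (index (P ∘ suc) x Px)

  index-injective : ∀ {n} (P : BSet n) x y Px Py → index P x Px ≡ index P y Py → x ≡ y
  index-injective {suc n} P zero    zero    P0 _  eq = refl
  index-injective {suc n} P zero    (suc y) P0 _  eq = ⊥-elim (first≢skip (P zero) P0 _ eq)
  index-injective {suc n} P (suc x) zero    _  P0 eq = ⊥-elim (first≢skip (P zero) P0 _ (sym eq))
  index-injective {suc n} P (suc x) (suc y) Px Py eq =
    cong suc (index-injective (P ∘ suc) x y Px Py (skip-injective (P zero) eq))

  count-≥-injection : ∀ {m n} (P : BSet n) (f : Fin m → Fin n) →
    (∀ i → P (f i) ≡ true) → Injective _≡_ _≡_ f → m ≤ count P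
  count-≥-injection P f f∈P f-injective = injective⇒≤ {f = λ i → index P (f i) (f∈P i)}
    (f-injective ∘ index-injective P _ _ (f∈P _) (f∈P _))

sum-∖⁅⁆ : ∀ {n} (P : BSet n) x (f : Fin n → ℕ) →
  sum (λ y → χ (P y) * f y) ≡ χ (P x) * f x + sum (λ y → χ ((P ∖ ⁅ x ⁆) y) * f y)
sum-∖⁅⁆ P x f = begin
  sum (λ y → χ (P y) * f y)            ≡⟨ sum-cong-≗ split ⟩
  sum (λ y → at-x y + rest y)          ≡⟨ ∑-distrib-+ at-x rest ⟩
  sum at-x + sum rest                  ≡⟨ cong (_+ sum rest) (sum-⁅⁆ x (λ y → χ (P y) * f y)) ⟩
  χ (P x) * f x + sum rest             ∎
  where
  open ≡-Reasoning
  at-x rest : Fin _ → ℕ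
  at-x y = χ (⁅ x ⁆ y) * (χ (P y) * f y)
  rest y = χ ((P ∖ ⁅ x ⁆) y) * f y
  split : ∀ y → χ (P y) * f y ≡ χ (⁅ x ⁆ y) * (χ (P y) * f y) + χ ((P ∖ ⁅ x ⁆) y) * f y
  split y with ⁅ x ⁆ y | P y
  ... | true  | true  = sym (trans (+-identityʳ _) (+-identityʳ _))
  ... | true  | false = refl
  ... | false | true  = refl
  ... | false | false = refl

module Degrees {n : ℕ} (G : Graph n) where

  degree : Fin n → ℕ
  degree x = count (adj G x)

  inDeg outDeg : BSet n → Fin n → ℕ
  inDeg  S x = count (adj G x ∩ S)
  outDeg S x = count (adj G x ∖ S)

  boundary : BSet n → ℕ
  boundary S = sum (λ y → χ (S y) * outDeg S y)

  inDeg-≐ : ∀ {S T} → S ≐ T → ∀ x → inDeg S x ≡ inDeg T x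
  inDeg-≐ S≐T x = count-≐ (cong (adj G x _ ∧_) ∘ S≐T)

  outDeg-≐ : ∀ {S T} → S ≐ T → ∀ x → outDeg S x ≡ outDeg T x
  outDeg-≐ S≐T x = count-≐ (cong (λ b → adj G x _ ∧ not b) ∘ S≐T)

  boundary-≐ : ∀ {S T} → S ≐ T → boundary S ≡ boundary T
  boundary-≐ S≐T = sum-cong-≗ λ y → cong₂ (λ b o → χ b * o) (S≐T y) (outDeg-≐ S≐T y)

  degree-split : ∀ S x → degree x ≡ inDeg S x + outDeg S x
  degree-split S x = count-split (adj G x) S

  outDeg-∖⁅⁆ : ∀ S x → S x ≡ true → ∀ y → outDeg (S ∖ ⁅ x ⁆) y ≡ outDeg S y + χ (adj G y x)
  outDeg-∖⁅⁆ S x Sx y = trans (sum-cong-≗ split)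
    (trans (∑-distrib-+ (χ ∘ (adj G y ∖ S)) (λ z → χ (⁅ x ⁆ z) * χ (adj G y z)))
                          (cong (outDeg S y +_) (sum-⁅⁆ x (χ ∘ adj G y))))
    where
    split : ∀ z → χ ((adj G y ∖ (S ∖ ⁅ x ⁆)) z) ≡ χ ((adj G y ∖ S) z) + χ (⁅ x ⁆ z) * χ (adj G y z)
    split z with z ≟ x
    ... | yes refl rewrite Sx with adj G y z
    ...   | true  = refl
    ...   | false = refl
    split z | no _ with adj G y z | S z
    ...   | true  | true  = refl
    ...   | true  | false = refl
    ...   | false | _     = refl

  outDeg-∖-non-adjacent : ∀ S R y → (∀ z → adj G y z ≡ true → R z ≡ false) → outDeg (S ∖ R) y ≡ outDeg S y
  outDeg-∖-non-adjacent S R y no-edge = count-≐ same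
    where
    same : adj G y ∖ (S ∖ R) ≐ adj G y ∖ S
    same z with adj G y z in yz
    ... | false = refl
    ... | true rewrite no-edge z yz = cong not (B.∧-identityʳ (S z))

  boundary-∖⁅⁆ : ∀ S x → S x ≡ true → boundary (S ∖ ⁅ x ⁆) + degree x ≡ boundary S + 2 * inDeg S x
  boundary-∖⁅⁆ S x Sx = begin
    boundary (S ∖ ⁅ x ⁆) + degree x
      ≡⟨ cong₂ _+_ (trans (sum-cong-≗ inside) (∑-distrib-+ out-part adj-part)) (degree-split S x) ⟩
    (Σ-out + sum adj-part) + (inDeg S x + outDeg S x)
      ≡⟨ cong (λ t → (Σ-out + t) + (inDeg S x + outDeg S x)) (sum-cong-≗ neighbour) ⟩
    (Σ-out + inDeg S x) + (inDeg S x + outDeg S x)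
      ≡⟨ regroup Σ-out (inDeg S x) (outDeg S x) ⟩
    (outDeg S x + Σ-out) + 2 * inDeg S x
      ≡⟨ cong (λ t → (t + Σ-out) + 2 * inDeg S x) (sym (*-identityˡ (outDeg S x))) ⟩
    (1 * outDeg S x + Σ-out) + 2 * inDeg S x
      ≡⟨ cong (λ b → (χ b * outDeg S x + Σ-out) + 2 * inDeg S x) (sym Sx) ⟩
    (χ (S x) * outDeg S x + Σ-out) + 2 * inDeg S x
      ≡⟨ cong (_+ 2 * inDeg S x) (sym (sum-∖⁅⁆ S x (outDeg S))) ⟩
    boundary S + 2 * inDeg S x ∎
    where
    open ≡-Reasoning
    S′ : BSet n
    S′ = S ∖ ⁅ x ⁆
    out-part adj-part : Fin n → ℕ
    out-part y = χ (S′ y) * outDeg S y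
    adj-part y = χ (S′ y) * χ (adj G y x)
    Σ-out : ℕ
    Σ-out = sum out-part
    inside : ∀ y → χ (S′ y) * outDeg S′ y ≡ out-part y + adj-part y
    inside y = trans (cong (χ (S′ y) *_) (outDeg-∖⁅⁆ S x Sx y)) (*-distribˡ-+ (χ (S′ y)) _ _)
    neighbour : ∀ y → adj-part y ≡ χ ((adj G x ∩ S) y)
    neighbour y with y ≟ x
    ... | yes refl rewrite Graph.irrefl G y | Sx = refl
    ... | no _ rewrite Graph.sym G y x with adj G x y | S y
    ...   | true  | true  = refl
    ...   | true  | false = refl
    ...   | false | true  = refl
    ...   | false | false = refl
    regroup : ∀ s d o → (s + d) + (d + o) ≡ (o + s) + 2 * d
    regroup = solve-∀

deg≡degree : ∀ {n} (G : Graph n) x → deg G x ≡ Degrees.degree G x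
deg≡degree G x = ∣tabulate∣≡count (adj G x)

degIn≡inDeg : ∀ {n} (G : Graph n) T x → degIn G (tabulate T) x ≡ Degrees.inDeg G T x
degIn≡inDeg G T x = trans (∣∣≡count (N G x Sub.∩ tabulate T)) (count-≐ λ z →
  trans (lookup-zipWith _∧_ z (N G x) (tabulate T)) (cong₂ _∧_ (lookup∘tabulate (adj G x) z) (lookup∘tabulate T z)))

∣GoodSet∣≡count : ∀ {n} (G : Graph n) B T c → ∣ GoodSet G B (tabulate T) c ∣ ≡
  count (λ x → lookup B x ∧ T x ∧ (Degrees.degree G x ≤ᵇ Degrees.inDeg G T x + c))
∣GoodSet∣≡count G B T c =
  trans (∣tabulate∣≡count (λ x → lookup B x ∧ lookup (tabulate T) x ∧ (deg G x ≤ᵇ degIn G (tabulate T) x + c)))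
        (count-≐ λ x → cong₂ (λ t d → lookup B x ∧ t ∧ d) (lookup∘tabulate T x)
                              (cong₂ (λ d d′ → d ≤ᵇ d′ + c) (deg≡degree G x) (degIn≡inDeg G T x)))

module Peelings {n : ℕ} (G : Graph n) where
  open Degrees G

  MinDegIn≥ : BSet n → ℕ → Set
  MinDegIn≥ T θ = ∀ x → T x ≡ true → θ ≤ inDeg T x

  -- done asks only for S ≐ T, as sets are functions and equal only pointwise
  data Peeling (θ : ℕ) : BSet n → BSet n → ℕ → Set where
    done : ∀ {S T} → S ≐ T → Peeling θ S T 0
    step : ∀ {S T r} x → S x ≡ true → inDeg S x < θ → Peeling θ (S ∖ ⁅ x ⁆) T r → Peeling θ S T (suc r)

  Peeling-respˡ : ∀ {θ S S′ T r} → S ≐ S′ → Peeling θ S T r → Peeling θ S′ T r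
  Peeling-respˡ S≐S′ (done S≐T) = done λ y → trans (sym (S≐S′ y)) (S≐T y)
  Peeling-respˡ S≐S′ (step x Sx lt p) =
    step x (trans (sym (S≐S′ x)) Sx) (subst (_< _) (inDeg-≐ S≐S′ x) lt)
      (Peeling-respˡ (λ y → cong (_∧ _) (S≐S′ y)) p)

  Peeling-respʳ : ∀ {θ S T T′ r} → T ≐ T′ → Peeling θ S T r → Peeling θ S T′ r
  Peeling-respʳ T≐T′ (done S≐T)       = done λ y → trans (S≐T y) (T≐T′ y)
  Peeling-respʳ T≐T′ (step x Sx lt p) = step x Sx lt (Peeling-respʳ T≐T′ p)

  _++_ : ∀ {θ S T U r r′} → Peeling θ S T r → Peeling θ T U r′ → Peeling θ S U (r + r′)
  done S≐T         ++ q = Peeling-respˡ (sym ∘ S≐T) q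
  step x Sx lt p ++ q = step x Sx lt (p ++ q)

  Peeling-mono : ∀ {θ θ′ S T r} → θ ≤ θ′ → Peeling θ S T r → Peeling θ′ S T r
  Peeling-mono θ≤θ′ (done S≐T)       = done S≐T
  Peeling-mono θ≤θ′ (step x Sx lt p) = step x Sx (≤-trans lt θ≤θ′) (Peeling-mono θ≤θ′ p)

  count-Peeling : ∀ {θ S T r} → Peeling θ S T r → count S ≡ count T + r
  count-Peeling {T = T} (done S≐T) = trans (count-≐ S≐T) (sym (+-identityʳ (count T)))
  count-Peeling {S = S} {T} (step {r = r} x Sx lt p) = begin
    count S                    ≡⟨ count-remove S x Sx ⟩
    suc (count (S ∖ ⁅ x ⁆))    ≡⟨ cong suc (count-Peeling p) ⟩
    suc (count T + r)          ≡⟨ sym (+-suc (count T) r) ⟩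
    count T + suc r            ∎
    where open ≡-Reasoning

  core : ∀ θ S → Σ (BSet n) λ T → Σ ℕ λ r → Peeling θ S T r × MinDegIn≥ T θ
  core θ S = go (count S) S ≤-refl
    where
    go : ∀ f S → count S ≤ f → Σ (BSet n) λ T → Σ ℕ λ r → Peeling θ S T r × MinDegIn≥ T θ
    go f S S≤f with any? (λ x → (S x B.≟ true) ×-dec (inDeg S x <? θ))
    ... | no none = S , 0 , done (λ _ → refl) , λ x Sx → ≮⇒≥ (λ lt → none (x , Sx , lt))
    go zero S S≤f | yes (x , Sx , lt) =
      ⊥-elim (1+n≰n (≤-trans (subst (_≤ 0) (count-remove S x Sx) S≤f) z≤n))
    go (suc f) S S≤f | yes (x , Sx , lt) with go f (S ∖ ⁅ x ⁆) (≤-pred (subst (_≤ suc f) (count-remove S x Sx) S≤f))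
    ... | T , r , p , T-thick = T , suc r , step x Sx lt p , T-thick

-- b and b′ are the boundary sizes before and after deleting a vertex of degree g with d inner neighbours
boundary-drop : ∀ {K b b′ g d} → b′ + g ≡ b + 2 * d → 9 * K ≤ g → d < 2 * K → b′ + 5 * K + 2 ≤ b
boundary-drop {K} {b} {b′} {g} {d} eq 9K≤g d<2K = +-cancelʳ-≤ (4 * K) _ _ (begin
  b′ + 5 * K + 2 + 4 * K ≡⟨ e₁ b′ K ⟩
  b′ + 9 * K + 2         ≤⟨ +-monoˡ-≤ 2 (+-monoʳ-≤ b′ 9K≤g) ⟩
  b′ + g + 2             ≡⟨ cong (_+ 2) eq ⟩
  b + 2 * d + 2          ≡⟨ e₂ b d ⟩
  b + 2 * suc d          ≤⟨ +-monoʳ-≤ b (*-monoʳ-≤ 2 d<2K) ⟩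
  b + 2 * (2 * K)        ≡⟨ e₃ b K ⟩
  b + 4 * K              ∎)
  where
  open ≤-Reasoning
  e₁ : ∀ b′ K → b′ + 5 * K + 2 + 4 * K ≡ b′ + 9 * K + 2
  e₁ = solve-∀
  e₂ : ∀ b d → b + 2 * d + 2 ≡ b + 2 * suc d
  e₂ = solve-∀
  e₃ : ∀ b K → b + 2 * (2 * K) ≡ b + 4 * K
  e₃ = solve-∀

-- c′ = |S ∖ x|, and P, P′ = |B ∩ S|, |B ∩ (S ∖ x)|
deletion-gain : ∀ {K D c′ b b′ P P′} → 1 ≤ D → b′ + 5 * K + 2 ≤ b → P ≤ suc P′ →
  3 * K * c′ + 2 * D * b′ + 1 + 4 * D * K * P ≤ 4 * D * K * P′ + (3 * K * suc c′ + 2 * D * b)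
deletion-gain {K} {D} {c′} {b} {b′} {P} {P′} 1≤D drop P≤1+P′ = begin
  3 * K * c′ + 2 * D * b′ + 1 + 4 * D * K * P
    ≤⟨ +-monoʳ-≤ (3 * K * c′ + 2 * D * b′ + 1) (*-monoʳ-≤ (4 * D * K) P≤1+P′) ⟩
  3 * K * c′ + 2 * D * b′ + 1 + 4 * D * K * suc P′
    ≡⟨ e₁ K D c′ b′ P′ ⟩
  (4 * D * K * P′ + 3 * K * c′ + 2 * D * b′ + 4 * D * K) + 1
    ≤⟨ +-monoʳ-≤ (4 * D * K * P′ + 3 * K * c′ + 2 * D * b′ + 4 * D * K) 1≤rest ⟩
  (4 * D * K * P′ + 3 * K * c′ + 2 * D * b′ + 4 * D * K) + (3 * K + 6 * D * K + 3 * D + D)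
    ≡⟨ e₂ K D c′ b′ P′ ⟩
  4 * D * K * P′ + (3 * K * suc c′ + 2 * D * (b′ + 5 * K + 2))
    ≤⟨ +-monoʳ-≤ (4 * D * K * P′) (+-monoʳ-≤ (3 * K * suc c′) (*-monoʳ-≤ (2 * D) drop)) ⟩
  4 * D * K * P′ + (3 * K * suc c′ + 2 * D * b) ∎
  where
  open ≤-Reasoning
  1≤rest : 1 ≤ 3 * K + 6 * D * K + 3 * D + D
  1≤rest = ≤-trans 1≤D (m≤n+m D (3 * K + 6 * D * K + 3 * D))
  e₁ : ∀ K D c′ b′ P′ → 3 * K * c′ + 2 * D * b′ + 1 + 4 * D * K * suc P′ ≡
                        (4 * D * K * P′ + 3 * K * c′ + 2 * D * b′ + 4 * D * K) + 1
  e₁ = solve-∀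
  e₂ : ∀ K D c′ b′ P′ → (4 * D * K * P′ + 3 * K * c′ + 2 * D * b′ + 4 * D * K) + (3 * K + 6 * D * K + 3 * D + D) ≡
                        4 * D * K * P′ + (3 * K * suc c′ + 2 * D * (b′ + 5 * K + 2))
  e₂ = solve-∀

module Potential {n : ℕ} (G : Graph n) (K D : ℕ) (B : BSet n) where
  open Degrees G
  open Peelings G

  -- The potential of S is pot⁺ S − pot⁻ S. Gain S r T says that it grows by at least r from S
  -- to T, and Admissible C S that it is at least −C.
  pot⁺ pot⁻ : BSet n → ℕ
  pot⁺ S = 4 * D * K * count (B ∩ S)
  pot⁻ S = 3 * K * count S + 2 * D * boundary S

  pot⁺-≐ : ∀ {S T} → S ≐ T → pot⁺ S ≡ pot⁺ T
  pot⁺-≐ S≐T = cong (4 * D * K *_) (count-≐ (cong (B _ ∧_) ∘ S≐T))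

  pot⁻-≐ : ∀ {S T} → S ≐ T → pot⁻ S ≡ pot⁻ T
  pot⁻-≐ S≐T = cong₂ (λ c b → 3 * K * c + 2 * D * b) (count-≐ S≐T) (boundary-≐ S≐T)

  count-∩-∖⁅⁆ : ∀ S x → count (B ∩ S) ≤ suc (count (B ∩ (S ∖ ⁅ x ⁆)))
  count-∩-∖⁅⁆ S x = begin
    count (B ∩ S)                              ≡⟨ count-∖⁅⁆ (B ∩ S) x ⟩
    χ (B x ∧ S x) + count ((B ∩ S) ∖ ⁅ x ⁆)
      ≤⟨ +-mono-≤ (χ≤1 _) (≤-reflexive (count-≐ λ y → B.∧-assoc (B y) (S y) _)) ⟩
    suc (count (B ∩ (S ∖ ⁅ x ⁆)))              ∎
    where open ≤-Reasoning

  Gain : BSet n → ℕ → BSet n → Set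
  Gain S r T = pot⁻ T + r + pot⁺ S ≤ pot⁺ T + pot⁻ S

  Gain-≐ : ∀ {S T} → S ≐ T → Gain S 0 T
  Gain-≐ {S} {T} S≐T rewrite pot⁺-≐ S≐T | pot⁻-≐ S≐T =
    ≤-reflexive (trans (cong (_+ pot⁺ T) (+-identityʳ (pot⁻ T))) (+-comm (pot⁻ T) (pot⁺ T)))

  Gain-trans : ∀ {S T U r₁ r₂} → Gain S r₁ T → Gain T r₂ U → Gain S (r₁ + r₂) U
  Gain-trans {S} {T} {U} {r₁} {r₂} S→T T→U = +-cancelʳ-≤ (pot⁻ T + pot⁺ T) _ _ (begin
    pot⁻ U + (r₁ + r₂) + pot⁺ S + (pot⁻ T + pot⁺ T)
      ≡⟨ shuffle₁ (pot⁻ U) r₁ r₂ (pot⁺ S) (pot⁻ T) (pot⁺ T) ⟩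
    (pot⁻ T + r₁ + pot⁺ S) + (pot⁻ U + r₂ + pot⁺ T)
      ≤⟨ +-mono-≤ S→T T→U ⟩
    (pot⁺ T + pot⁻ S) + (pot⁺ U + pot⁻ T)
      ≡⟨ shuffle₂ (pot⁺ T) (pot⁻ S) (pot⁺ U) (pot⁻ T) ⟩
    pot⁺ U + pot⁻ S + (pot⁻ T + pot⁺ T) ∎)
    where
    open ≤-Reasoning
    shuffle₁ : ∀ nU r₁ r₂ pS nT pT → nU + (r₁ + r₂) + pS + (nT + pT) ≡ (nT + r₁ + pS) + (nU + r₂ + pT)
    shuffle₁ = solve-∀
    shuffle₂ : ∀ pT nS pU nT → (pT + nS) + (pU + nT) ≡ pU + nS + (nT + pT)
    shuffle₂ = solve-∀

  Gain-∖⁅⁆ : ∀ S x → 1 ≤ D → S x ≡ true → 9 * K ≤ degree x → inDeg S x < 2 * K → Gain S 1 (S ∖ ⁅ x ⁆)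
  Gain-∖⁅⁆ S x 1≤D Sx 9K≤deg inDeg<2K rewrite count-remove S x Sx =
    deletion-gain 1≤D (boundary-drop {K} (boundary-∖⁅⁆ S x Sx) 9K≤deg inDeg<2K) (count-∩-∖⁅⁆ S x)

  pot⁺-Empty : ∀ {T} → Empty T → pot⁺ T ≡ 0
  pot⁺-Empty {T} T-empty =
    trans (cong (4 * D * K *_) (count-empty λ y → trans (cong (B y ∧_) (T-empty y)) (B.∧-zeroʳ (B y))))
          (*-zeroʳ (4 * D * K))

  pot⁻-Empty : ∀ {T} → Empty T → pot⁻ T ≡ 0
  pot⁻-Empty {T} T-empty = trans (cong₂ (λ c b → 3 * K * c + 2 * D * b) (count-empty T-empty) boundary≡0)
                                 (cong₂ _+_ (*-zeroʳ (3 * K)) (*-zeroʳ (2 * D)))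
    where
    boundary≡0 : boundary T ≡ 0
    boundary≡0 = trans (sum-cong-≗ λ y → cong (λ b → χ b * outDeg T y) (T-empty y)) (sum-replicate-zero n)

  Admissible : ℕ → BSet n → Set
  Admissible C S = pot⁻ S ≤ pot⁺ S + C

  Gain-Admissible : ∀ {C S T r} → Gain S r T → Admissible C S → pot⁻ T + r ≤ pot⁺ T + C
  Gain-Admissible {C} {S} {T} {r} gain admissible = +-cancelʳ-≤ (pot⁺ S) _ _ (begin
    pot⁻ T + r + pot⁺ S     ≤⟨ gain ⟩
    pot⁺ T + pot⁻ S         ≤⟨ +-monoʳ-≤ (pot⁺ T) admissible ⟩
    pot⁺ T + (pot⁺ S + C)   ≡⟨ cong (pot⁺ T +_) (+-comm (pot⁺ S) C) ⟩
    pot⁺ T + (C + pot⁺ S)   ≡⟨ sym (+-assoc (pot⁺ T) C (pot⁺ S)) ⟩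
    pot⁺ T + C + pot⁺ S     ∎)
    where open ≤-Reasoning

  Admissible-side : ∀ {C S S₁ S₂ T₁ T₂ r₁ r₂} → Gain S₁ r₁ T₁ → Gain S₂ r₂ T₂ →
    pot⁻ S₁ + pot⁻ S₂ ≤ pot⁻ S + C → pot⁺ S ≤ pot⁺ S₁ + pot⁺ S₂ → Admissible C S →
    Admissible C T₁ ⊎ Admissible C T₂
  Admissible-side {C} {S} {S₁} {S₂} {T₁} {T₂} {r₁} {r₂} gain₁ gain₂ split⁻ split⁺ admissible
    with pot⁻ T₁ ≤? pot⁺ T₁ + C
  ... | yes admissible₁ = inj₁ admissible₁
  ... | no  ¬admissible₁ = inj₂ (+-cancelˡ-≤ (pot⁺ T₁ + C) _ _
          (≤-trans (+-monoˡ-≤ (pot⁻ T₂) (<⇒≤ (≰⇒> ¬admissible₁))) both))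
    where
    open ≤-Reasoning
    drop-r : ∀ {S T r} → Gain S r T → pot⁻ T + pot⁺ S ≤ pot⁺ T + pot⁻ S
    drop-r {S} {T} {r} gain = ≤-trans (+-monoˡ-≤ (pot⁺ S) (m≤m+n (pot⁻ T) r)) gain
    regroup : ∀ a b c C → a + b + (c + C + C) ≡ (a + C) + (b + C) + c
    regroup = solve-∀
    both : pot⁻ T₁ + pot⁻ T₂ ≤ (pot⁺ T₁ + C) + (pot⁺ T₂ + C)
    both = +-cancelʳ-≤ (pot⁺ S₁ + pot⁺ S₂) _ _ (begin
      (pot⁻ T₁ + pot⁻ T₂) + (pot⁺ S₁ + pot⁺ S₂)
        ≡⟨ interchange (pot⁻ T₁) (pot⁻ T₂) (pot⁺ S₁) (pot⁺ S₂) ⟩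
      (pot⁻ T₁ + pot⁺ S₁) + (pot⁻ T₂ + pot⁺ S₂)
        ≤⟨ +-mono-≤ (drop-r gain₁) (drop-r gain₂) ⟩
      (pot⁺ T₁ + pot⁻ S₁) + (pot⁺ T₂ + pot⁻ S₂)
        ≡⟨ interchange (pot⁺ T₁) (pot⁻ S₁) (pot⁺ T₂) (pot⁻ S₂) ⟩
      (pot⁺ T₁ + pot⁺ T₂) + (pot⁻ S₁ + pot⁻ S₂)
        ≤⟨ +-monoʳ-≤ (pot⁺ T₁ + pot⁺ T₂) split⁻ ⟩
      (pot⁺ T₁ + pot⁺ T₂) + (pot⁻ S + C)
        ≤⟨ +-monoʳ-≤ (pot⁺ T₁ + pot⁺ T₂) (+-monoˡ-≤ C (≤-trans admissible (+-monoˡ-≤ C split⁺))) ⟩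
      (pot⁺ T₁ + pot⁺ T₂) + (pot⁺ S₁ + pot⁺ S₂ + C + C)
        ≡⟨ regroup (pot⁺ T₁) (pot⁺ T₂) (pot⁺ S₁ + pot⁺ S₂) C ⟩
      (pot⁺ T₁ + C) + (pot⁺ T₂ + C) + (pot⁺ S₁ + pot⁺ S₂) ∎)

  Gain-Peeling : ∀ {θ S T r} → θ ≤ 2 * K → 1 ≤ D → (∀ x → 9 * K ≤ degree x) → Peeling θ S T r → Gain S r T
  Gain-Peeling θ≤2K 1≤D 9K≤deg (done S≐T) = Gain-≐ S≐T
  Gain-Peeling θ≤2K 1≤D 9K≤deg (step {S} x Sx lt p) =
    Gain-trans (Gain-∖⁅⁆ S x 1≤D Sx (9K≤deg x) (≤-trans lt θ≤2K)) (Gain-Peeling θ≤2K 1≤D 9K≤deg p)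

module Connectivity {n : ℕ} (G : Graph n) where

  ∈⇒lookup : ∀ {P : Subset n} {x} → x Sub.∈ P → lookup P x ≡ true
  ∈⇒lookup = []=⇒lookup

  lookup⇒∈ : ∀ {P : Subset n} {x} → lookup P x ≡ true → x Sub.∈ P
  lookup⇒∈ = lookup⇒[]= _ _

  Closed : Subset n → BSet n → Set
  Closed P R = ∀ {y z} → R y ≡ true → lookup P z ≡ true → Adj G y z → R z ≡ true

  walk-snoc : ∀ {P u y z} → Walk G P u y → Adj G y z → z Sub.∈ P → Walk G P u z
  walk-snoc here           yz z∈P = next yz z∈P here
  walk-snoc (next uw w∈P p) yz z∈P = next uw w∈P (walk-snoc p yz z∈P)

  Closed-walk : ∀ {P R u v} → Closed P R → R u ≡ true → Walk G P u v → R v ≡ true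
  Closed-walk closed Ru here             = Ru
  Closed-walk closed Ru (next uw w∈P p) = Closed-walk closed (closed Ru (∈⇒lookup w∈P) uw) p

  -- the component of u in G[P] (empty if u ∉ P)
  record Component (P : Subset n) (u : Fin n) : Set where
    field
      R      : BSet n
      R⊆P    : R ⊆ lookup P
      closed : Closed P R
      reach  : ∀ {y} → R y ≡ true → Walk G P u y
      u∈R    : lookup P u ≡ true → R u ≡ true

  component : ∀ P u → Component P u
  component P u = grow n R₀ (m≤n+m n (count R₀)) R₀⊆P reach₀ u∈R₀
    where
    R₀ : BSet n
    R₀ = ⁅ u ⁆ ∩ lookup P

    R₀⊆P : R₀ ⊆ lookup P
    R₀⊆P y = B.∧-conicalʳ (⁅ u ⁆ y) (lookup P y)

    reach₀ : ∀ {y} → R₀ y ≡ true → Walk G P u y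
    reach₀ {y} R₀y with y ≟ u
    ... | yes refl = here

    u∈R₀ : lookup P u ≡ true → R₀ u ≡ true
    u∈R₀ Pu = cong₂ _∧_ (dec-true (u ≟ u) refl) Pu

    grow : ∀ f R → n ≤ count R + f → R ⊆ lookup P → (∀ {y} → R y ≡ true → Walk G P u y) →
           (lookup P u ≡ true → R u ≡ true) → Component P u
    grow f R bound R⊆P reach u∈R
      with any? (λ y → any? (λ z → (R y B.≟ true) ×-dec (lookup P z B.≟ true) ×-dec
                                   (R z B.≟ false) ×-dec (adj G y z B.≟ true)))
    ... | no stuck = record { R = R ; R⊆P = R⊆P ; closed = closed ; reach = reach ; u∈R = u∈R }
      where
      closed : Closed P R
      closed {y} {z} Ry Pz yz with R z in Rz
      ... | true  = refl
      ... | false = ⊥-elim (stuck (y , z , Ry , Pz , Rz , yz))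
    grow zero R bound _ _ _ | yes (_ , z , _ , _ , Rz , _) =
      ⊥-elim (1+n≰n (≤-trans (subst (_≤ n) (count-insert R z Rz) (count-≤ (R ∪ ⁅ z ⁆)))
                             (≤-trans bound (≤-reflexive (+-identityʳ (count R))))))
    grow (suc f) R bound R⊆P reach u∈R | yes (y , z , Ry , Pz , Rz , yz) =
      grow f (R ∪ ⁅ z ⁆) bound′ R′⊆P reach′ (λ Pu → cong (_∨ ⁅ z ⁆ u) (u∈R Pu))
      where
      bound′ : n ≤ count (R ∪ ⁅ z ⁆) + f
      bound′ = subst (n ≤_) (trans (+-suc (count R) f) (cong (_+ f) (sym (count-insert R z Rz)))) bound

      R′⊆P : R ∪ ⁅ z ⁆ ⊆ lookup P
      R′⊆P w R′w with R w in Rw | w ≟ z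
      ... | true  | _        = R⊆P w Rw
      ... | false | yes refl = Pz

      reach′ : ∀ {w} → (R ∪ ⁅ z ⁆) w ≡ true → Walk G P u w
      reach′ {w} R′w with R w in Rw | w ≟ z
      ... | true  | _        = reach Rw
      ... | false | yes refl = walk-snoc (reach Ry) yz (lookup⇒∈ Pz)

  record Disconnection (P : Subset n) : Set where
    field
      R      : BSet n
      R⊆P    : R ⊆ lookup P
      closed : Closed P R
      u v    : Fin n
      u∈R    : R u ≡ true
      v∈P    : lookup P v ≡ true
      v∉R    : R v ≡ false

  Disconnection⇒¬Connected : ∀ {P} → Disconnection P → ¬ Connected G P
  Disconnection⇒¬Connected d connected = true≢false (trans (sym v∈R) v∉R)
    where
    open Disconnection d
    v∈R : R v ≡ true
    v∈R = Closed-walk closed u∈R (connected u v (lookup⇒∈ (R⊆P u u∈R)) (lookup⇒∈ v∈P))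

  connected-or-disconnection : ∀ P → Connected G P ⊎ Disconnection P
  connected-or-disconnection P
    with any? (λ u → any? (λ v → (lookup P u B.≟ true) ×-dec (lookup P v B.≟ true) ×-dec (R u v B.≟ false)))
    where R : Fin n → BSet n
          R u = Component.R (component P u)
  ... | yes (u , v , Pu , Pv , v∉R) = inj₂ record
    { R = R ; R⊆P = R⊆P ; closed = closed ; u = u ; v = v ; u∈R = u∈R Pu ; v∈P = Pv ; v∉R = v∉R }
    where open Component (component P u)
  ... | no none = inj₁ connected
    where
    connected : Connected G P
    connected u v u∈P v∈P with Component.R (component P u) v in v∈R
    ... | true  = Component.reach (component P u) v∈R
    ... | false = ⊥-elim (none (u , v , ∈⇒lookup u∈P , ∈⇒lookup v∈P , v∈R))

  disconnection? : ∀ P → Dec (Disconnection P)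
  disconnection? P with connected-or-disconnection P
  ... | inj₁ connected = no λ d → Disconnection⇒¬Connected d connected
  ... | inj₂ d         = yes d

  Separator : ℕ → Subset n → Set
  Separator k S = Σ (Subset n) λ X → X Sub.⊆ S × ∣ X ∣ < k × Disconnection (S Sub.∩ Sub.∁ X)

  KConnected-or-Separator : ∀ k S → k < ∣ S ∣ → KConnected G k S ⊎ Separator k S
  KConnected-or-Separator k S k<∣S∣
    with anySubset? (λ X → (X ⊆? S) ×-dec (∣ X ∣ <? k) ×-dec disconnection? (S Sub.∩ Sub.∁ X))
  ... | yes separator = inj₂ separator
  ... | no none       = inj₁ (k<∣S∣ , connected)
    where
    connected : ∀ X → X Sub.⊆ S → ∣ X ∣ < k → Connected G (S Sub.∩ Sub.∁ X)
    connected X X⊆S small with connected-or-disconnection (S Sub.∩ Sub.∁ X)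
    ... | inj₁ c = c
    ... | inj₂ d = ⊥-elim (none (X , X⊆S , small , d))

module Sides {n : ℕ} (G : Graph n) (S Q R : BSet n)
  (disjoint : ∀ y → Q y ≡ true → R y ≡ false)
  (no-edge : ∀ y z → Q y ≡ true → R z ≡ true → adj G y z ≡ false) where
  open Degrees G
  open Peelings G

  S₁ S₂ X : BSet n
  S₁ = S ∖ Q
  S₂ = S ∖ R
  X  = S ∖ Q ∖ R

  private
    not-both : ∀ {y} → Q y ≡ true → R y ≡ true → ⊥
    not-both Qy Ry = true≢false (trans (sym Ry) (disjoint _ Qy))

    no-R-neighbour : ∀ {y} → Q y ≡ true → ∀ z → adj G y z ≡ true → R z ≡ false
    no-R-neighbour {y} Qy z yz with R z in Rz
    ... | false = refl
    ... | true  = ⊥-elim (true≢false (trans (sym yz) (no-edge y z Qy Rz)))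

    no-Q-neighbour : ∀ {y} → R y ≡ true → ∀ z → adj G y z ≡ true → Q z ≡ false
    no-Q-neighbour {y} Ry z yz with Q z in Qz
    ... | false = refl
    ... | true  = ⊥-elim (true≢false (trans (sym yz) (trans (Graph.sym G y z) (no-edge z y Qz Ry))))

  count-sides : count S₁ + count S₂ ≡ count S + count X
  count-sides = begin
    count S₁ + count S₂          ≡⟨ sym (∑-distrib-+ (χ ∘ S₁) (χ ∘ S₂)) ⟩
    sum (λ y → χ (S₁ y) + χ (S₂ y)) ≡⟨ sum-cong-≗ pointwise ⟩
    sum (λ y → χ (S y) + χ (X y))   ≡⟨ ∑-distrib-+ (χ ∘ S) (χ ∘ X) ⟩
    count S + count X            ∎
    where
    open ≡-Reasoning
    pointwise : ∀ y → χ (S₁ y) + χ (S₂ y) ≡ χ (S y) + χ (X y)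
    pointwise y with S y | Q y in Qy | R y in Ry
    ... | false | _     | _     = refl
    ... | true  | true  | true  = ⊥-elim (not-both Qy Ry)
    ... | true  | true  | false = refl
    ... | true  | false | true  = refl
    ... | true  | false | false = refl

  count-∩-sides : ∀ A → count (A ∩ S) ≤ count (A ∩ S₁) + count (A ∩ S₂)
  count-∩-sides A = ≤-trans (sum-mono-≤ pointwise) (≤-reflexive (∑-distrib-+ (χ ∘ (A ∩ S₁)) (χ ∘ (A ∩ S₂))))
    where
    pointwise : ∀ y → χ ((A ∩ S) y) ≤ χ ((A ∩ S₁) y) + χ ((A ∩ S₂) y)
    pointwise y with A y | S y | Q y in Qy | R y in Ry
    ... | false | _     | _     | _     = z≤n
    ... | true  | false | _     | _     = z≤n
    ... | true  | true  | true  | true  = ⊥-elim (not-both Qy Ry)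
    ... | true  | true  | true  | false = ≤-refl
    ... | true  | true  | false | _     = s≤s z≤n

  outDeg-sides : ∀ y → outDeg S₁ y + outDeg S₂ y ≤ outDeg S y + degree y
  outDeg-sides y = begin
    outDeg S₁ y + outDeg S₂ y               ≡⟨ sym (∑-distrib-+ (χ ∘ (adj G y ∖ S₁)) (χ ∘ (adj G y ∖ S₂))) ⟩
    sum (λ z → χ ((adj G y ∖ S₁) z) + χ ((adj G y ∖ S₂) z)) ≤⟨ sum-mono-≤ pointwise ⟩
    sum (λ z → χ ((adj G y ∖ S) z) + χ (adj G y z))          ≡⟨ ∑-distrib-+ (χ ∘ (adj G y ∖ S)) (χ ∘ adj G y) ⟩
    outDeg S y + degree y                   ∎
    where
    open ≤-Reasoning
    pointwise : ∀ z → χ ((adj G y ∖ S₁) z) + χ ((adj G y ∖ S₂) z) ≤ χ ((adj G y ∖ S) z) + χ (adj G y z)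
    pointwise z with adj G y z | S z | Q z in Qz | R z in Rz
    ... | false | _     | _     | _     = z≤n
    ... | true  | false | _     | _     = ≤-refl
    ... | true  | true  | true  | true  = ⊥-elim (not-both Qz Rz)
    ... | true  | true  | true  | false = s≤s z≤n
    ... | true  | true  | false | true  = s≤s z≤n
    ... | true  | true  | false | false = z≤n

  boundary-sides : ∀ {D} → (∀ y → degree y ≤ D) → boundary S₁ + boundary S₂ ≤ boundary S + D * count X
  boundary-sides {D} deg≤D = begin
    boundary S₁ + boundary S₂
      ≡⟨ sym (∑-distrib-+ (λ y → χ (S₁ y) * outDeg S₁ y) (λ y → χ (S₂ y) * outDeg S₂ y)) ⟩
    sum (λ y → χ (S₁ y) * outDeg S₁ y + χ (S₂ y) * outDeg S₂ y)
      ≤⟨ sum-mono-≤ pointwise ⟩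
    sum (λ y → χ (S y) * outDeg S y + D * χ (X y))
      ≡⟨ ∑-distrib-+ (λ y → χ (S y) * outDeg S y) (λ y → D * χ (X y)) ⟩
    boundary S + sum (λ y → D * χ (X y))
      ≡⟨ cong (boundary S +_) (sym (*-distribˡ-sum D (χ ∘ X))) ⟩
    boundary S + D * count X ∎
    where
    open ≤-Reasoning
    pointwise : ∀ y → χ (S₁ y) * outDeg S₁ y + χ (S₂ y) * outDeg S₂ y ≤ χ (S y) * outDeg S y + D * χ (X y)
    pointwise y with S y in Sy | Q y in Qy | R y in Ry
    ... | false | _     | _     = z≤n
    ... | true  | true  | true  = ⊥-elim (not-both Qy Ry)
    ... | true  | true  | false = ≤-trans (*-monoʳ-≤ 1 (≤-reflexive (outDeg-∖-non-adjacent S R y (no-R-neighbour Qy))))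
                                          (m≤m+n _ _)
    ... | true  | false | true  = ≤-trans (≤-reflexive (+-identityʳ _))
                                    (≤-trans (*-monoʳ-≤ 1 (≤-reflexive (outDeg-∖-non-adjacent S Q y (no-Q-neighbour Ry))))
                                             (m≤m+n _ _))
    ... | true  | false | false = begin
      1 * outDeg S₁ y + 1 * outDeg S₂ y ≡⟨ cong₂ _+_ (*-identityˡ (outDeg S₁ y)) (*-identityˡ (outDeg S₂ y)) ⟩
      outDeg S₁ y + outDeg S₂ y         ≤⟨ outDeg-sides y ⟩
      outDeg S y + degree y             ≤⟨ +-mono-≤ (≤-reflexive (sym (*-identityˡ _)))
                                                     (≤-trans (deg≤D y) (≤-reflexive (sym (*-identityʳ D)))) ⟩
      1 * outDeg S y + D * 1            ∎

  R-between-sides : ∀ {x} → S₁ x ≡ true → S₂ x ≡ false → R x ≡ true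
  R-between-sides {x} S₁x S₂x with S x | R x
  ... | _     | true  = refl
  ... | true  | false = ⊥-elim (true≢false S₂x)
  ... | false | false = ⊥-elim (true≢false (sym S₁x))

  S≐S₁∪S₂ : S ≐ S₁ ∪ S₂
  S≐S₁∪S₂ y with S y | Q y in Qy | R y in Ry
  ... | false | _     | _     = refl
  ... | true  | true  | true  = ⊥-elim (not-both Qy Ry)
  ... | true  | true  | false = refl
  ... | true  | false | _     = refl

  inDeg-∪-S₂ : ∀ T x → R x ≡ true → inDeg (T ∪ S₂) x ≤ inDeg T x + count X
  inDeg-∪-S₂ T x Rx = ≤-trans (sum-mono-≤ pointwise) (≤-reflexive (∑-distrib-+ (χ ∘ (adj G x ∩ T)) (χ ∘ X)))
    where
    pointwise : ∀ z → χ ((adj G x ∩ (T ∪ S₂)) z) ≤ χ ((adj G x ∩ T) z) + χ (X z)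
    pointwise z with adj G x z in xz | T z
    ... | false | _    = z≤n
    ... | true  | true = s≤s z≤n
    ... | true  | false rewrite no-Q-neighbour Rx z xz with S z | R z
    ...   | false | _     = z≤n
    ...   | true  | true  = z≤n
    ...   | true  | false = ≤-refl

  -- Replay the peeling on top of S₂: vertices of X stay, and a deleted vertex of R has no
  -- neighbours in S₂ outside X.
  lift-Peeling : ∀ {θ T E r} → T ⊆ S₁ → Peeling θ T E r →
                 Σ ℕ λ r′ → Peeling (θ + count X) (T ∪ S₂) (E ∪ S₂) r′
  lift-Peeling T⊆S₁ (done T≐E) = 0 , done λ y → cong (_∨ S₂ y) (T≐E y)
  lift-Peeling {θ} {T} T⊆S₁ (step x Tx lt p)
    with lift-Peeling (λ y → T⊆S₁ y ∘ B.∧-conicalˡ (T y) _) p | S₂ x in S₂x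
  ... | r′ , q | true  = r′ , Peeling-respˡ x-kept q
    where
    x-kept : T ∖ ⁅ x ⁆ ∪ S₂ ≐ T ∪ S₂
    x-kept y with y ≟ x
    ... | yes refl rewrite S₂x = trans (B.∨-zeroʳ _) (sym (B.∨-zeroʳ (T y)))
    ... | no _ = cong (_∨ S₂ y) (B.∧-identityʳ (T y))
  ... | r′ , q | false = suc r′ , step x (cong (_∨ S₂ x) Tx) in<θ+X (Peeling-respˡ x-removed q)
    where
    x-removed : T ∖ ⁅ x ⁆ ∪ S₂ ≐ (T ∪ S₂) ∖ ⁅ x ⁆
    x-removed y with y ≟ x
    ... | yes refl rewrite S₂x with T y
    ...   | true  = refl
    ...   | false = refl
    x-removed y | no _ with T y | S₂ y
    ...   | true  | _     = refl
    ...   | false | true  = refl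
    ...   | false | false = refl
    in<θ+X : inDeg (T ∪ S₂) x < θ + count X
    in<θ+X = ≤-<-trans (inDeg-∪-S₂ T x (R-between-sides (T⊆S₁ x Tx) S₂x)) (+-monoˡ-< (count X) lt)

  Peeling-away-S₁ : ∀ {θ E r} → Peeling θ S₁ E r → Empty E → Σ ℕ λ r′ → Peeling (θ + count X) S S₂ r′
  Peeling-away-S₁ p E-empty with lift-Peeling (λ _ S₁y → S₁y) p
  ... | r′ , q = r′ , Peeling-respˡ (sym ∘ S≐S₁∪S₂) (Peeling-respʳ (λ y → cong (_∨ S₂ y) (E-empty y)) q)

module Cycles {n : ℕ} (G : Graph n) where

  -- the walk w 0, …, w L; values of w beyond L are irrelevant
  record NonBacktracking (w : ℕ → Fin n) (L : ℕ) : Set where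
    field
      adjacent  : ∀ i → i < L → Adj G (w i) (w (suc i))
      no-return : ∀ i → 2 + i ≤ L → w i ≢ w (2 + i)

  module _ {w : ℕ → Fin n} {L : ℕ} (walk : NonBacktracking w L) where
    open NonBacktracking walk

    DistinctBelow : ℕ → Set
    DistinctBelow j = ∀ {i i′} → i < j → i′ < j → w i ≡ w i′ → i ≡ i′

    FirstRepeat : ℕ → Set
    FirstRepeat j = Σ ℕ λ i → i < j × w i ≡ w j × DistinctBelow j

    distinct-or-repeat : ∀ j → DistinctBelow j ⊎ Σ ℕ λ j′ → j′ < j × FirstRepeat j′
    distinct-or-repeat zero = inj₁ λ ()
    distinct-or-repeat (suc j) with distinct-or-repeat j
    ... | inj₂ (j′ , j′<j , repeat) = inj₂ (j′ , m≤n⇒m≤1+n j′<j , repeat)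
    ... | inj₁ distinct with any? (λ (t : Fin j) → w (toℕ t) ≟ w j)
    ...   | yes (t , wt≡wj) = inj₂ (j , n<1+n j , toℕ t , toℕ<n t , wt≡wj , distinct)
    ...   | no  new         = inj₁ distinct′
      where
      distinct′ : DistinctBelow (suc j)
      distinct′ {i} {i′} (s≤s i≤j) (s≤s i′≤j) eq with m≤n⇒m<n∨m≡n i≤j | m≤n⇒m<n∨m≡n i′≤j
      ... | inj₁ i<j   | inj₁ i′<j  = distinct i<j i′<j eq
      ... | inj₁ i<j   | inj₂ refl  = ⊥-elim (new (fromℕ< i<j , trans (cong w (toℕ-fromℕ< i<j)) eq))
      ... | inj₂ refl  | inj₁ i′<j  = ⊥-elim (new (fromℕ< i′<j , trans (cong w (toℕ-fromℕ< i′<j)) (sym eq)))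
      ... | inj₂ refl  | inj₂ refl  = refl

    repeat-length≥3 : ∀ i e → suc i + e ≤ L → w i ≡ w (suc i + e) → 3 ≤ suc e
    repeat-length≥3 i zero bound eq = ⊥-elim (true≢false (trans (sym loop) (Graph.irrefl G (w i))))
      where
      loop : Adj G (w i) (w i)
      loop = subst (Adj G (w i)) (sym (trans eq (cong (w ∘ suc) (+-identityʳ i))))
                   (adjacent i (subst (_≤ L) (cong suc (+-identityʳ i)) bound))
    repeat-length≥3 i (suc zero) bound eq =
      ⊥-elim (no-return i (subst (_≤ L) (cong suc (+-comm i 1)) bound) (trans eq (cong (w ∘ suc) (+-comm i 1))))
    repeat-length≥3 i (suc (suc e)) bound eq = s≤s (s≤s (s≤s z≤n))

    cycle-at-repeat : ∀ i e → suc i + e ≤ L → w i ≡ w (suc i + e) → DistinctBelow (suc i + e) → Cycle G (suc e)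
    cycle-at-repeat i e bound eq distinct = record
      { vert  = λ t → w (i + toℕ t)
      ; inj   = λ t t′ eq′ → toℕ-injective (+-cancelˡ-≡ i _ _ (distinct (index< t) (index< t′) eq′))
      ; long  = repeat-length≥3 i e bound eq
      ; step  = step
      ; close = close
      }
      where
      index< : ∀ (t : Fin (suc e)) → i + toℕ t < suc i + e
      index< t = s≤s (+-monoʳ-≤ i (≤-pred (toℕ<n t)))
      step : ∀ t t′ → toℕ t′ ≡ suc (toℕ t) → Adj G (w (i + toℕ t)) (w (i + toℕ t′))
      step t t′ t′≡1+t = subst (Adj G (w (i + toℕ t)) ∘ w) (sym t′-after-t)
        (adjacent (i + toℕ t) (≤-trans (≤-reflexive (sym t′-after-t)) (≤-trans (≤-pred (index< t′)) (<⇒≤ bound))))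
        where
        t′-after-t : i + toℕ t′ ≡ suc (i + toℕ t)
        t′-after-t = trans (cong (i +_) t′≡1+t) (+-suc i (toℕ t))
      close : ∀ t t′ → toℕ t ≡ 0 → suc (toℕ t′) ≡ suc e → Adj G (w (i + toℕ t′)) (w (i + toℕ t))
      close t t′ t≡0 t′≡e rewrite t≡0 | suc-injective t′≡e | +-identityʳ i =
        subst (Adj G (w (i + e))) (sym eq) (adjacent (i + e) bound)

    repeat⇒cycle : ∀ {i j} → i < j → j ≤ L → w i ≡ w j → Σ ℕ λ l → l ≤ L × Cycle G l
    repeat⇒cycle {i} {j} i<j j≤L wi≡wj with distinct-or-repeat (suc j)
    ... | inj₁ distinct = ⊥-elim (<⇒≢ i<j (distinct (m≤n⇒m≤1+n i<j) (n<1+n j) wi≡wj))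
    ... | inj₂ (j′ , j′≤j , i′ , i′<j′ , eq , distinct) with m≤n⇒∃[o]m+o≡n i′<j′
    ...   | e , refl = suc e , ≤-trans (s≤s (m≤n+m e i′)) j′≤L
                     , cycle-at-repeat i′ e j′≤L eq distinct
      where
      j′≤L : suc i′ + e ≤ L
      j′≤L = ≤-trans (≤-pred j′≤j) j≤L

  _◂_ : Fin n → (ℕ → Fin n) → ℕ → Fin n
  (u ◂ w) zero    = u
  (u ◂ w) (suc i) = w i

  ◂-NonBacktracking : ∀ {u w L} → NonBacktracking w L → Adj G u (w 0) → (1 ≤ L → u ≢ w 1) →
    NonBacktracking (u ◂ w) (suc L)
  ◂-NonBacktracking {u} {w} {L} walk u-w₀ u≢w₁ = record { adjacent = adjacent′ ; no-return = no-return′ }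
    where
    open NonBacktracking walk
    adjacent′ : ∀ i → i < suc L → Adj G ((u ◂ w) i) ((u ◂ w) (suc i))
    adjacent′ zero    _         = u-w₀
    adjacent′ (suc i) (s≤s i<L) = adjacent i i<L
    no-return′ : ∀ i → 2 + i ≤ suc L → (u ◂ w) i ≢ (u ◂ w) (2 + i)
    no-return′ zero    (s≤s 1≤L)   = u≢w₁ 1≤L
    no-return′ (suc i) (s≤s 2+i≤L) = no-return i 2+i≤L

  module _ {P Q : ℕ → Fin n} {p q : ℕ} (P-walk : NonBacktracking P p) (Q-walk : NonBacktracking Q q)
    (same-start : P 0 ≡ Q 0) (diverge : P 1 ≢ Q 1) where
    open NonBacktracking

    joined : ℕ → Fin n
    joined i with i ≤? p
    ... | yes _ = P (p ∸ i)
    ... | no  _ = Q (i ∸ p)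

    joined-P : ∀ {i} d → i + d ≡ p → joined i ≡ P d
    joined-P {i} d i+d≡p with i ≤? p
    ... | yes _   = cong P (trans (cong (_∸ i) (sym i+d≡p)) (m+n∸m≡n i d))
    ... | no  i≰p = ⊥-elim (i≰p (subst (i ≤_) i+d≡p (m≤m+n i d)))

    joined-Q : ∀ d → joined (p + d) ≡ Q d
    joined-Q d with p + d ≤? p
    ... | no  _     = cong Q (m+n∸m≡n p d)
    ... | yes p+d≤p with refl ← n≤0⇒n≡0 (+-cancelˡ-≤ p d 0 (subst (p + d ≤_) (sym (+-identityʳ p)) p+d≤p)) =
      trans (cong P (m≤n⇒m∸n≡0 (m≤m+n p 0))) same-start

    before-or-after : ∀ i → (Σ ℕ λ d → suc i + d ≡ p) ⊎ (Σ ℕ λ d → p + d ≡ i)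
    before-or-after i with i <? p
    ... | yes i<p = inj₁ (m≤n⇒∃[o]m+o≡n i<p)
    ... | no  i≮p = inj₂ (m≤n⇒∃[o]m+o≡n (≮⇒≥ i≮p))

    joined-NonBacktracking : NonBacktracking joined (p + q)
    joined-NonBacktracking = record { adjacent = adjacent′ ; no-return = no-return′ }
      where
      adjacent′ : ∀ i → i < p + q → Adj G (joined i) (joined (suc i))
      adjacent′ i i<p+q with before-or-after i
      ... | inj₁ (d , i+1+d≡p) =
        subst₂ (Adj G) (sym (joined-P (suc d) (trans (+-suc i d) i+1+d≡p))) (sym (joined-P d i+1+d≡p))
          (trans (Graph.sym G (P (suc d)) (P d)) (adjacent P-walk d (subst (suc d ≤_) i+1+d≡p (s≤s (m≤n+m d i)))))
      ... | inj₂ (d , refl) =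
        subst₂ (Adj G) (sym (joined-Q d)) (sym (trans (cong joined (sym (+-suc p d))) (joined-Q (suc d))))
          (adjacent Q-walk d (+-cancelˡ-≤ p _ _ (subst (_≤ p + q) (sym (+-suc p d)) i<p+q)))
      no-return′ : ∀ i → 2 + i ≤ p + q → joined i ≢ joined (2 + i)
      no-return′ i 2+i≤p+q with before-or-after i
      ... | inj₁ (zero , i+1+0≡p) = λ eq → diverge (begin
        P 1               ≡⟨ sym (joined-P 1 (trans (+-comm i 1) i+1≡p)) ⟩
        joined i          ≡⟨ eq ⟩
        joined (2 + i)    ≡⟨ cong (joined ∘ suc) i+1≡p ⟩
        joined (suc p)    ≡⟨ cong joined (+-comm 1 p) ⟩
        joined (p + 1)    ≡⟨ joined-Q 1 ⟩
        Q 1               ∎)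
        where
        open ≡-Reasoning
        i+1≡p : suc i ≡ p
        i+1≡p = trans (cong suc (sym (+-identityʳ i))) i+1+0≡p
      ... | inj₁ (suc d , i+2+d≡p) = λ eq → no-return P-walk d (subst (2 + d ≤_) i+2+d≡p′ (s≤s (s≤s (m≤n+m d i))))
          (sym (trans (sym (joined-P (2 + d) (trans (+-suc i (suc d)) i+2+d≡p))) (trans eq (joined-P d i+2+d≡p′))))
        where
        i+2+d≡p′ : 2 + i + d ≡ p
        i+2+d≡p′ = trans (cong suc (sym (+-suc i d))) i+2+d≡p
      ... | inj₂ (d , refl) = λ eq → no-return Q-walk d (+-cancelˡ-≤ p _ _ (subst (_≤ p + q) p+2+d≡ 2+i≤p+q))
          (trans (sym (joined-Q d)) (trans eq (trans (cong joined p+2+d≡) (joined-Q (2 + d)))))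
        where
        p+2+d≡ : 2 + (p + d) ≡ p + (2 + d)
        p+2+d≡ = sym (trans (+-suc p (suc d)) (cong suc (+-suc p d)))

    meet⇒cycle : 1 ≤ p → P p ≡ Q q → Σ ℕ λ l → l ≤ p + q × Cycle G l
    meet⇒cycle 1≤p meet = repeat⇒cycle joined-NonBacktracking {0} {p + q} (≤-trans 1≤p (m≤m+n p q)) ≤-refl
      (trans (joined-P p refl) (trans meet (sym (joined-Q q))))

remQuot-injective : ∀ {a} b {i j : Fin (a * b)} → remQuot {a} b i ≡ remQuot b j → i ≡ j
remQuot-injective {a} b {i} {j} eq =
  trans (sym (combine-remQuot {a} b i)) (trans (cong (uncurry combine) eq) (combine-remQuot {a} b j))

choices : ∀ {q} l → Fin (q ^ l) → Vec (Fin q) l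
choices         zero    _ = []
choices {q} (suc l) i = proj₁ (remQuot {q} (q ^ l) i) ∷ choices l (proj₂ (remQuot {q} (q ^ l) i))

choices-injective : ∀ {q} l {i j : Fin (q ^ l)} → choices l i ≡ choices l j → i ≡ j
choices-injective         zero    {zero} {zero} _  = refl
choices-injective {q} (suc l) eq with ∷-injective eq
... | c≡c′ , cs≡cs′ = remQuot-injective {q} (q ^ l) (cong₂ _,_ c≡c′ (choices-injective l cs≡cs′))

module Moore {n : ℕ} (G : Graph n) (S : BSet n) (q : ℕ) (S-thick : Peelings.MinDegIn≥ G S (suc q)) where
  open Degrees G
  open Cycles G

  -- q + 1 distinct neighbours of x inside S (x itself, as a junk value, if there are fewer)
  neighbour : Fin n → Fin (suc q) → Fin n
  neighbour x with suc q ≤? inDeg S x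
  ... | yes q<deg = λ i → enum (adj G x ∩ S) (inject≤ i q<deg)
  ... | no  _     = λ _ → x

  neighbour-∈ : ∀ {x} → S x ≡ true → ∀ i → (adj G x ∩ S) (neighbour x i) ≡ true
  neighbour-∈ {x} Sx i with suc q ≤? inDeg S x
  ... | yes q<deg = enum-∈ (adj G x ∩ S) (inject≤ i q<deg)
  ... | no  q≮deg = ⊥-elim (q≮deg (S-thick x Sx))

  neighbour-injective : ∀ {x} → S x ≡ true → ∀ {i j} → neighbour x i ≡ neighbour x j → i ≡ j
  neighbour-injective {x} Sx {i} {j} eq with suc q ≤? inDeg S x
  ... | yes q<deg = inject≤-injective q<deg q<deg i j (enum-injective (adj G x ∩ S) eq)
  ... | no  q≮deg = ⊥-elim (q≮deg (S-thick x Sx))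

  -- the position of p among the chosen neighbours of x (zero if it is not one of them)
  position : Fin n → Fin n → Fin (suc q)
  position p x with any? (λ i → neighbour x i ≟ p)
  ... | yes (i , _) = i
  ... | no  _       = zero

  -- the c-th chosen neighbour of x other than p
  forward : Fin n → Fin n → Fin q → Fin n
  forward p x c = neighbour x (punchIn (position p x) c)

  forward-adj : ∀ {p x} c → S x ≡ true → Adj G x (forward p x c)
  forward-adj c Sx = B.∧-conicalˡ _ _ (neighbour-∈ Sx _)

  forward-∈ : ∀ {p x} c → S x ≡ true → S (forward p x c) ≡ true
  forward-∈ {x = x} c Sx = B.∧-conicalʳ (adj G x _) _ (neighbour-∈ Sx _)

  forward-≢ : ∀ {p x} c → S x ≡ true → forward p x c ≢ p
  forward-≢ {p} {x} c Sx eq with any? (λ i → neighbour x i ≟ p)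
  ... | yes (i , nᵢ≡p) = punchInᵢ≢i i c (neighbour-injective Sx (trans eq (sym nᵢ≡p)))
  ... | no  absent     = absent (punchIn zero c , eq)

  forward-injective : ∀ {p x} → S x ≡ true → ∀ {c c′} → forward p x c ≡ forward p x c′ → c ≡ c′
  forward-injective {p} {x} Sx eq = punchIn-injective (position p x) _ _ (neighbour-injective Sx eq)

  -- the walk from x (entered from p) that takes the choices cs
  walk : ∀ {l} → Fin n → Fin n → Vec (Fin q) l → ℕ → Fin n
  walk p x cs       zero    = x
  walk p x []       (suc i) = x
  walk p x (c ∷ cs) (suc i) = walk x (forward p x c) cs i

  walk-∈ : ∀ {l} p x (cs : Vec (Fin q) l) → S x ≡ true → ∀ i → S (walk p x cs i) ≡ true
  walk-∈ p x cs       Sx zero    = Sx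
  walk-∈ p x []       Sx (suc i) = Sx
  walk-∈ p x (c ∷ cs) Sx (suc i) = walk-∈ x (forward p x c) cs (forward-∈ c Sx) i

  walk-NonBacktracking : ∀ {l} p x (cs : Vec (Fin q) l) → S x ≡ true → NonBacktracking (walk p x cs) l
  walk-NonBacktracking p x cs Sx = record { adjacent = adjacent p x cs Sx ; no-return = no-return p x cs Sx }
    where
    adjacent : ∀ {l} p x (cs : Vec (Fin q) l) → S x ≡ true → ∀ i → i < l → Adj G (walk p x cs i) (walk p x cs (suc i))
    adjacent p x (c ∷ cs) Sx zero    _        = forward-adj c Sx
    adjacent p x (c ∷ cs) Sx (suc i) (s≤s i<l) = adjacent x (forward p x c) cs (forward-∈ c Sx) i i<l
    no-return : ∀ {l} p x (cs : Vec (Fin q) l) → S x ≡ true → ∀ i → 2 + i ≤ l → walk p x cs i ≢ walk p x cs (2 + i)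
    no-return p x (c ∷ c′ ∷ cs) Sx zero    _          = forward-≢ c′ (forward-∈ c Sx) ∘ sym
    no-return p x (c ∷ cs)      Sx (suc i) (s≤s 2+i≤l) = no-return x (forward p x c) cs (forward-∈ c Sx) i 2+i≤l

  walk-second-≢ : ∀ {l} p x (cs : Vec (Fin q) l) → 1 ≤ l → S x ≡ true → walk p x cs 1 ≢ p
  walk-second-≢ p x (c ∷ cs) _ Sx = forward-≢ c Sx

  module _ {m : ℕ} (girth : Girth≥ G (2 * m + 2)) where

    no-short-cycle : ∀ {l} → l ≤ 2 * m + 1 → Cycle G l → ⊥
    no-short-cycle {l} l≤2m+1 cycle = 1+n≰n (≤-trans (subst (_≤ l) (+-suc (2 * m) 1) (girth l cycle)) l≤2m+1)

    walk-choices-injective : ∀ {l} → l ≤ m → ∀ p x → S x ≡ true → (cs cs′ : Vec (Fin q) l) →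
      walk p x cs l ≡ walk p x cs′ l → cs ≡ cs′
    walk-choices-injective l≤m p x Sx []       []         meet = refl
    walk-choices-injective {suc l} l≤m p x Sx (c ∷ cs) (c′ ∷ cs′) meet with c ≟ c′
    ... | yes refl =
      cong (c ∷_) (walk-choices-injective (≤-trans (n≤1+n l) l≤m) x (forward p x c) (forward-∈ c Sx) cs cs′ meet)
    ... | no  c≢c′ with meet⇒cycle (walk-NonBacktracking p x (c ∷ cs) Sx) (walk-NonBacktracking p x (c′ ∷ cs′) Sx)
                          refl (c≢c′ ∘ forward-injective Sx) (s≤s z≤n) meet
    ...   | _ , length≤ , cycle =
      ⊥-elim (no-short-cycle (≤-trans length≤ (≤-trans (+-mono-≤ l≤m l≤m) m+m≤2m+1)) cycle)
      where
      m+m≤2m+1 : m + m ≤ 2 * m + 1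
      m+m≤2m+1 = ≤-trans (≤-reflexive (cong (m +_) (sym (+-identityʳ m)))) (m≤m+n (2 * m) 1)

    module _ (1≤m : 1 ≤ m) {u : Fin n} (Su : S u ≡ true) where

      v : Fin n
      v = neighbour u zero

      Sv : S v ≡ true
      Sv = B.∧-conicalʳ (adj G u v) _ (neighbour-∈ Su zero)

      -- a common end would close a cycle of length at most 2m + 1 through the edge uv
      ends-apart : ∀ cs cs′ → walk v u cs m ≢ walk u v cs′ m
      ends-apart cs cs′ meet
        with meet⇒cycle (walk-NonBacktracking v u cs Su)
               (◂-NonBacktracking (walk-NonBacktracking u v cs′ Sv) (B.∧-conicalˡ _ _ (neighbour-∈ Su zero))
                                  (λ _ → walk-second-≢ u v cs′ 1≤m Sv ∘ sym))
               refl (walk-second-≢ v u cs 1≤m Su) 1≤m meet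
      ... | _ , length≤ , cycle = no-short-cycle (≤-trans length≤ (≤-reflexive (m+1+m≡2m+1 m))) cycle
        where
        m+1+m≡2m+1 : ∀ l → l + suc l ≡ 2 * l + 1
        m+1+m≡2m+1 = solve-∀

      end : Fin 2 → Vec (Fin q) m → Fin n
      end zero       cs = walk v u cs m
      end (suc zero) cs = walk u v cs m

      end-∈ : ∀ b cs → S (end b cs) ≡ true
      end-∈ zero       cs = walk-∈ v u cs Su m
      end-∈ (suc zero) cs = walk-∈ u v cs Sv m

      end-injective : ∀ {b b′ cs cs′} → end b cs ≡ end b′ cs′ → b ≡ b′ × cs ≡ cs′
      end-injective {zero}     {zero}     eq = refl , walk-choices-injective ≤-refl v u Su _ _ eq
      end-injective {suc zero} {suc zero} eq = refl , walk-choices-injective ≤-refl u v Sv _ _ eq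
      end-injective {zero}     {suc zero} eq = ⊥-elim (ends-apart _ _ eq)
      end-injective {suc zero} {zero}     eq = ⊥-elim (ends-apart _ _ (sym eq))

      2q^m≤count : 2 * q ^ m ≤ count S
      2q^m≤count = count-≥-injection S endpoint (λ i → end-∈ (proj₁ (choice i)) (proj₂ (choice i))) endpoint-injective
        where
        choice : Fin (2 * q ^ m) → Fin 2 × Vec (Fin q) m
        choice i = proj₁ (remQuot {2} (q ^ m) i) , choices m (proj₂ (remQuot {2} (q ^ m) i))
        endpoint : Fin (2 * q ^ m) → Fin n
        endpoint = uncurry end ∘ choice
        endpoint-injective : Injective _≡_ _≡_ endpoint
        endpoint-injective {i} {j} eq with end-injective {proj₁ (choice i)} {proj₁ (choice j)} eq
        ... | b≡b′ , cs≡cs′ = remQuot-injective {2} (q ^ m) (cong₂ _,_ b≡b′ (choices-injective m cs≡cs′))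

empty-or-inhabited : ∀ {n} (P : BSet n) → Empty P ⊎ ∃ λ x → P x ≡ true
empty-or-inhabited P with any? (λ x → P x B.≟ true)
... | yes inhabited = inj₂ inhabited
... | no  none      = inj₁ λ x → B.¬-not (λ Px → none (x , Px))

module Construction {n : ℕ} (G : Graph n) (k D m : ℕ) (B : BSet n) (x₀ : Fin n)
  (2≤k : 2 ≤ k) (1≤D : 1 ≤ D) (1≤m : 1 ≤ m)
  (δ≥9k² : MinDeg≥ G (9 * (k * k))) (Δ≤D : MaxDeg≤ G D) (girth : Girth≥ G (2 * m + 2))
  (moore : 11 * (k * k) * (D * D) ≤ 2 * (k * k ∸ 1) ^ m) where

  open Degrees G
  open Peelings G
  open Connectivity G

  9k²≤deg : ∀ x → 9 * (k * k) ≤ degree x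
  9k²≤deg x = subst (9 * (k * k) ≤_) (deg≡degree G x) (δ≥9k² x)

  deg≤D : ∀ x → degree x ≤ D
  deg≤D x = subst (_≤ D) (deg≡degree G x) (Δ≤D x)

  k²≤D : k * k ≤ D
  k²≤D = ≤-trans (m≤m+n (k * k) (8 * (k * k))) (≤-trans (9k²≤deg x₀) (deg≤D x₀))

  K : ℕ
  K = k * k

  open Potential G K D B

  -- each of the fewer than k separator vertices costs at most 3K + 2D² of potential (pot⁻-sides)
  C : ℕ
  C = k * (3 * K + 2 * D * D)

  N₀ : ℕ
  N₀ = 11 * K * (D * D)

  1≤k : 1 ≤ k
  1≤k = ≤-trans (s≤s z≤n) 2≤k

  k≤K : k ≤ K
  k≤K = ≤-trans (≤-reflexive (sym (*-identityʳ k))) (*-monoʳ-≤ k 1≤k)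

  K≤2K : K ≤ 2 * K
  K≤2K = m≤m+n K (K + 0)

  C<N₀ : C < N₀
  C<N₀ = begin-strict
    k * (3 * K + 2 * D * D)          ≤⟨ *-mono-≤ k≤K (+-monoˡ-≤ (2 * D * D) (*-monoʳ-≤ 3 K≤D²)) ⟩
    K * (3 * (D * D) + 2 * D * D)    ≡⟨ e₁ K D ⟩
    5 * (K * (D * D)) + 0            <⟨ +-monoʳ-< (5 * (K * (D * D))) (≤-trans 1≤KD² (m≤n*m _ 6)) ⟩
    5 * (K * (D * D)) + 6 * (K * (D * D)) ≡⟨ e₂ K D ⟩
    11 * K * (D * D)                 ∎
    where
    open ≤-Reasoning
    K≤D² : K ≤ D * D
    K≤D² = ≤-trans k²≤D (≤-trans (≤-reflexive (sym (*-identityʳ D))) (*-monoʳ-≤ D 1≤D))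
    1≤KD² : 1 ≤ K * (D * D)
    1≤KD² = *-mono-≤ (≤-trans 1≤k k≤K) (*-mono-≤ 1≤D 1≤D)
    e₁ : ∀ K D → K * (3 * (D * D) + 2 * D * D) ≡ 5 * (K * (D * D)) + 0
    e₁ = solve-∀
    e₂ : ∀ K D → 5 * (K * (D * D)) + 6 * (K * (D * D)) ≡ 11 * K * (D * D)
    e₂ = solve-∀

  k<N₀ : k < N₀
  k<N₀ = ≤-<-trans (≤-trans (≤-reflexive (sym (*-identityʳ k))) (*-monoʳ-≤ k 1≤cost)) C<N₀
    where
    1≤cost : 1 ≤ 3 * K + 2 * D * D
    1≤cost = ≤-trans (*-mono-≤ 1≤D 1≤D)
               (≤-trans (m≤n*m (D * D) 2) (≤-trans (≤-reflexive (sym (*-assoc 2 D D))) (m≤n+m _ _)))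

  N₀≤count : ∀ {S u} → MinDegIn≥ S K → S u ≡ true → N₀ ≤ count S
  N₀≤count {S} S-thick Su = ≤-trans moore (Moore.2q^m≤count G S (K ∸ 1) S-thick′ girth 1≤m Su)
    where
    S-thick′ : MinDegIn≥ S (suc (K ∸ 1))
    S-thick′ x Sx = subst (_≤ inDeg S x) (sym (trans (+-comm 1 (K ∸ 1)) (m∸n+n≡m (≤-trans 1≤k k≤K)))) (S-thick x Sx)

  record Candidate (S : BSet n) : Set where
    field
      thick      : MinDegIn≥ S K
      vertex     : Fin n
      vertex∈S   : S vertex ≡ true
      admissible : Admissible C S

  peeled-Candidate : ∀ {S T r} → Candidate S → Peeling (2 * K) S T r → MinDegIn≥ T K → Candidate T
  peeled-Candidate {S} {T} {r} S-candidate peeling T-thick = candidate (empty-or-inhabited T)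
    where
    open Candidate S-candidate
    T-bound : pot⁻ T + r ≤ pot⁺ T + C
    T-bound = Gain-Admissible (Gain-Peeling ≤-refl 1≤D 9k²≤deg peeling) admissible
    candidate : Empty T ⊎ ∃ (λ w → T w ≡ true) → Candidate T
    candidate (inj₂ (w , Tw)) = record
      { thick = T-thick ; vertex = w ; vertex∈S = Tw ; admissible = ≤-trans (m≤m+n (pot⁻ T) r) T-bound }
    candidate (inj₁ T-empty) = ⊥-elim (<⇒≱ C<N₀ (begin
      N₀             ≤⟨ N₀≤count thick vertex∈S ⟩
      count S        ≡⟨ count-Peeling peeling ⟩
      count T + r    ≡⟨ cong (_+ r) (count-empty T-empty) ⟩
      r              ≤⟨ subst₂ (λ a b → a + r ≤ b + C) (pot⁻-Empty T-empty) (pot⁺-Empty T-empty) T-bound ⟩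
      C              ∎))
      where open ≤-Reasoning

  Smaller : BSet n → Set
  Smaller S = Σ (BSet n) λ T → Candidate T × count T < count S

  module Split {S : BSet n} (S-candidate : Candidate S) (separator : Separator k (tabulate S)) where
    open Candidate S-candidate

    Xˢ : Subset n
    Xˢ = proj₁ separator

    ∣Xˢ∣<k : ∣ Xˢ ∣ < k
    ∣Xˢ∣<k = proj₁ (proj₂ (proj₂ separator))

    open Disconnection (proj₂ (proj₂ (proj₂ separator)))

    lookup-S∖Xˢ : ∀ y → lookup (tabulate S Sub.∩ Sub.∁ Xˢ) y ≡ (S ∖ lookup Xˢ) y
    lookup-S∖Xˢ y = trans (lookup-zipWith _∧_ y (tabulate S) (Sub.∁ Xˢ))
                          (cong₂ _∧_ (lookup∘tabulate S y) (lookup-map y not Xˢ))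

    Q : BSet n
    Q = S ∖ lookup Xˢ ∖ R

    Q-R-disjoint : ∀ y → Q y ≡ true → R y ≡ false
    Q-R-disjoint y Qy = trans (sym (B.not-involutive (R y))) (cong not (B.∧-conicalʳ _ (not (R y)) Qy))

    R-Q-disjoint : ∀ y → R y ≡ true → Q y ≡ false
    R-Q-disjoint y Ry with Q y in Qy
    ... | false = refl
    ... | true  = ⊥-elim (true≢false (trans (sym Ry) (Q-R-disjoint y Qy)))

    Q-R-no-edge : ∀ y z → Q y ≡ true → R z ≡ true → adj G y z ≡ false
    Q-R-no-edge y z Qy Rz with adj G y z in yz
    ... | false = refl
    ... | true  = ⊥-elim (true≢false (trans (sym (closed Rz y∈S∖Xˢ (trans (Graph.sym G z y) yz))) (Q-R-disjoint y Qy)))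
      where
      y∈S∖Xˢ : lookup (tabulate S Sub.∩ Sub.∁ Xˢ) y ≡ true
      y∈S∖Xˢ = trans (lookup-S∖Xˢ y) (B.∧-conicalˡ _ (not (R y)) Qy)

    R-Q-no-edge : ∀ y z → R y ≡ true → Q z ≡ true → adj G y z ≡ false
    R-Q-no-edge y z Ry Qz = trans (Graph.sym G y z) (Q-R-no-edge z y Qz Ry)

    module Σ₁ = Sides G S Q R Q-R-disjoint Q-R-no-edge
    module Σ₂ = Sides G S R Q R-Q-disjoint R-Q-no-edge

    Σ₁X⊆Xˢ : Σ₁.X ⊆ lookup Xˢ
    Σ₁X⊆Xˢ y Xy with S y | lookup Xˢ y | R y
    Σ₁X⊆Xˢ y () | false | _     | _
    Σ₁X⊆Xˢ y _  | true  | true  | _     = refl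
    Σ₁X⊆Xˢ y () | true  | false | true
    Σ₁X⊆Xˢ y () | true  | false | false

    Σ₂X⊆Xˢ : Σ₂.X ⊆ lookup Xˢ
    Σ₂X⊆Xˢ y Xy with S y | lookup Xˢ y | R y
    Σ₂X⊆Xˢ y () | false | _     | _
    Σ₂X⊆Xˢ y _  | true  | true  | _     = refl
    Σ₂X⊆Xˢ y () | true  | false | true
    Σ₂X⊆Xˢ y () | true  | false | false

    count<k : ∀ {Y} → Y ⊆ lookup Xˢ → count Y < k
    count<k Y⊆Xˢ = ≤-<-trans (count-mono Y⊆Xˢ) (subst (_< k) (∣∣≡count Xˢ) ∣Xˢ∣<k)

    K+count≤2K : ∀ {Y} → Y ⊆ lookup Xˢ → K + count Y ≤ 2 * K
    K+count≤2K Y⊆Xˢ = +-monoʳ-≤ K (≤-trans (<⇒≤ (count<k Y⊆Xˢ)) (≤-trans k≤K (m≤m+n K 0)))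

    S∖Xˢ⊆S : ∀ {y} → lookup (tabulate S Sub.∩ Sub.∁ Xˢ) y ≡ true → S y ≡ true
    S∖Xˢ⊆S {y} h = B.∧-conicalˡ (S y) _ (trans (sym (lookup-S∖Xˢ y)) h)

    S₁<S : count Σ₁.S₁ < count S
    S₁<S = count-⊂ v (λ y → B.∧-conicalˡ (S y) _) (S∖Xˢ⊆S v∈P)
                   (trans (cong (λ b → S v ∧ not b) Qv) (B.∧-zeroʳ (S v)))
      where
      Qv : Q v ≡ true
      Qv = cong₂ _∧_ (trans (sym (lookup-S∖Xˢ v)) v∈P) (cong not v∉R)

    S₂<S : count Σ₁.S₂ < count S
    S₂<S = count-⊂ u (λ y → B.∧-conicalˡ (S y) _) (S∖Xˢ⊆S (R⊆P u u∈R))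
                   (trans (cong (λ b → S u ∧ not b) u∈R) (B.∧-zeroʳ (S u)))

    pot⁻-sides : pot⁻ Σ₁.S₁ + pot⁻ Σ₁.S₂ ≤ pot⁻ S + C
    pot⁻-sides = begin
      (3 * K * c₁ + 2 * D * b₁) + (3 * K * c₂ + 2 * D * b₂)
        ≡⟨ regroup (3 * K) (2 * D) c₁ c₂ b₁ b₂ ⟩
      3 * K * (c₁ + c₂) + 2 * D * (b₁ + b₂)
        ≡⟨ cong (λ c → 3 * K * c + 2 * D * (b₁ + b₂)) Σ₁.count-sides ⟩
      3 * K * (c + x) + 2 * D * (b₁ + b₂)
        ≤⟨ +-monoʳ-≤ (3 * K * (c + x)) (*-monoʳ-≤ (2 * D) (Σ₁.boundary-sides deg≤D)) ⟩
      3 * K * (c + x) + 2 * D * (b + D * x)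
        ≡⟨ separate K D c x b ⟩
      (3 * K * c + 2 * D * b) + x * (3 * K + 2 * D * D)
        ≤⟨ +-monoʳ-≤ (pot⁻ S) (*-monoˡ-≤ (3 * K + 2 * D * D) (<⇒≤ (count<k Σ₁X⊆Xˢ))) ⟩
      pot⁻ S + C ∎
      where
      open ≤-Reasoning
      c₁ c₂ b₁ b₂ c b x : ℕ
      c₁ = count Σ₁.S₁
      c₂ = count Σ₁.S₂
      b₁ = boundary Σ₁.S₁
      b₂ = boundary Σ₁.S₂
      c = count S
      b = boundary S
      x = count Σ₁.X
      regroup : ∀ p q c₁ c₂ b₁ b₂ → (p * c₁ + q * b₁) + (p * c₂ + q * b₂) ≡ p * (c₁ + c₂) + q * (b₁ + b₂)
      regroup = solve-∀
      separate : ∀ K D c x b → 3 * K * (c + x) + 2 * D * (b + D * x) ≡ (3 * K * c + 2 * D * b) + x * (3 * K + 2 * D * D)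
      separate = solve-∀

    pot⁺-sides : pot⁺ S ≤ pot⁺ Σ₁.S₁ + pot⁺ Σ₁.S₂
    pot⁺-sides = ≤-trans (*-monoʳ-≤ (4 * D * K) (Σ₁.count-∩-sides B)) (≤-reflexive (*-distribˡ-+ (4 * D * K) _ _))

    Core : BSet n → Set
    Core S′ = Σ (BSet n) λ T → Σ ℕ λ r → Peeling K S′ T r × MinDegIn≥ T K

    smaller-from-cores : Core Σ₁.S₁ → Core Σ₁.S₂ → Smaller S
    smaller-from-cores (T₁ , r₁ , p₁ , T₁-thick) (T₂ , r₂ , p₂ , T₂-thick) =
      choose (empty-or-inhabited T₁) (empty-or-inhabited T₂)
      where
      T₁<S : count T₁ < count S
      T₁<S = ≤-<-trans (subst (count T₁ ≤_) (sym (count-Peeling p₁)) (m≤m+n (count T₁) r₁)) S₁<S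
      T₂<S : count T₂ < count S
      T₂<S = ≤-<-trans (subst (count T₂ ≤_) (sym (count-Peeling p₂)) (m≤m+n (count T₂) r₂)) S₂<S
      candidate : ∀ {T} → MinDegIn≥ T K → ∃ (λ w → T w ≡ true) → Admissible C T → Candidate T
      candidate T-thick (w , Tw) admissible′ = record { thick = T-thick ; vertex = w ; vertex∈S = Tw ; admissible = admissible′ }
      choose : Empty T₁ ⊎ ∃ (λ w → T₁ w ≡ true) → Empty T₂ ⊎ ∃ (λ w → T₂ w ≡ true) → Smaller S
      choose (inj₁ T₁-empty) _ =
        T₂ , peeled-Candidate S-candidate
               (Peeling-mono (K+count≤2K Σ₁X⊆Xˢ) (proj₂ (Σ₁.Peeling-away-S₁ p₁ T₁-empty)) ++ Peeling-mono K≤2K p₂)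
               T₂-thick , T₂<S
      choose (inj₂ _) (inj₁ T₂-empty) =
        T₁ , peeled-Candidate S-candidate
               (Peeling-mono (K+count≤2K Σ₂X⊆Xˢ) (proj₂ (Σ₂.Peeling-away-S₁ p₂ T₂-empty)) ++ Peeling-mono K≤2K p₁)
               T₁-thick , T₁<S
      choose (inj₂ T₁-inhabited) (inj₂ T₂-inhabited) =
        pick (Admissible-side (Gain-Peeling K≤2K 1≤D 9k²≤deg p₁) (Gain-Peeling K≤2K 1≤D 9k²≤deg p₂)
                              pot⁻-sides pot⁺-sides admissible)
        where
        pick : Admissible C T₁ ⊎ Admissible C T₂ → Smaller S
        pick (inj₁ admissible₁) = T₁ , candidate T₁-thick T₁-inhabited admissible₁ , T₁<S
        pick (inj₂ admissible₂) = T₂ , candidate T₂-thick T₂-inhabited admissible₂ , T₂<S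

    smaller : Smaller S
    smaller = smaller-from-cores (core K Σ₁.S₁) (core K Σ₁.S₂)

  KConnectedCandidate : Set
  KConnectedCandidate = Σ (BSet n) λ T → Candidate T × KConnected G k (tabulate T)

  KConnected-Candidate : ∀ {S} → Candidate S → KConnectedCandidate
  KConnected-Candidate {S} = go S (<-wellFounded (count S))
    where
    go : ∀ S → Acc _<_ (count S) → Candidate S → KConnectedCandidate
    go S (acc smaller-rec) S-candidate = branch (KConnected-or-Separator k (tabulate S) k<∣S∣)
      where
      open Candidate S-candidate
      k<∣S∣ : k < ∣ tabulate S ∣
      k<∣S∣ = subst (k <_) (sym (∣tabulate∣≡count S)) (<-≤-trans k<N₀ (N₀≤count thick vertex∈S))
      recurse : Smaller S → KConnectedCandidate
      recurse (T , T-candidate , T<S) = go T (smaller-rec T<S) T-candidate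
      branch : KConnected G k (tabulate S) ⊎ Separator k (tabulate S) → KConnectedCandidate
      branch (inj₁ k-connected) = S , S-candidate , k-connected
      branch (inj₂ separator)   = recurse (Split.smaller S-candidate separator)

  full-Candidate : n ≤ D * count B → Candidate (λ _ → true)
  full-Candidate n≤D∣B∣ = record
    { thick = λ y _ → subst (K ≤_) (sym inDeg-full) (≤-trans (m≤m+n K (8 * K)) (9k²≤deg y))
    ; vertex = x₀ ; vertex∈S = refl ; admissible = admissible }
    where
    inDeg-full : ∀ {y} → inDeg (λ _ → true) y ≡ degree y
    inDeg-full {y} = count-≐ (B.∧-identityʳ ∘ adj G y)
    boundary-full : boundary (λ _ → true) ≡ 0
    boundary-full = trans (sum-cong-≗ λ y → cong (1 *_) (count-empty (B.∧-zeroʳ ∘ adj G y))) (sum-replicate-zero n)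
    admissible : Admissible C (λ _ → true)
    admissible = begin
      3 * K * count {n} (λ _ → true) + 2 * D * boundary (λ _ → true)
        ≡⟨ cong₂ (λ c b → 3 * K * c + 2 * D * b) (count-full n) boundary-full ⟩
      3 * K * n + 2 * D * 0                ≡⟨ cong (3 * K * n +_) (*-zeroʳ (2 * D)) ⟩
      3 * K * n + 0                        ≡⟨ +-identityʳ (3 * K * n) ⟩
      3 * K * n                            ≤⟨ *-monoʳ-≤ (3 * K) n≤D∣B∣ ⟩
      3 * K * (D * count B)                ≤⟨ m≤m+n _ (D * K * count B) ⟩
      3 * K * (D * count B) + D * K * count B ≡⟨ regroup K D (count B) ⟩
      4 * D * K * count B                  ≡⟨ cong (4 * D * K *_) (count-≐ (B.∧-identityʳ ∘ B)) ⟨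
      4 * D * K * count (B ∩ (λ _ → true)) ≤⟨ m≤m+n _ C ⟩
      pot⁺ (λ _ → true) + C                ∎
      where
      open ≤-Reasoning
      regroup : ∀ K D b → 3 * K * (D * b) + D * K * b ≡ 4 * D * K * b
      regroup = solve-∀

  Good : BSet n → BSet n
  Good T x = B x ∧ T x ∧ (degree x ≤ᵇ inDeg T x + 2 * K)

  bad⇒2K<outDeg : ∀ T y → (degree y ≤ᵇ inDeg T y + 2 * K) ≡ false → 2 * K < outDeg T y
  bad⇒2K<outDeg T y bad = +-cancelˡ-< (inDeg T y) _ _
    (subst (inDeg T y + 2 * K <_) (degree-split T y) (≰⇒> λ le → subst Data.Bool.T bad (≤⇒≤ᵇ le)))

  -- each vertex of B ∩ T that is not good sends more than 2K edges out of T
  B∩-good-or-boundary : ∀ T → 2 * K * count (B ∩ T) ≤ 2 * K * count (Good T) + boundary T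
  B∩-good-or-boundary T = begin
    2 * K * count (B ∩ T)
      ≡⟨ *-distribˡ-sum (2 * K) (χ ∘ (B ∩ T)) ⟩
    sum (λ y → 2 * K * χ ((B ∩ T) y))
      ≤⟨ sum-mono-≤ pointwise ⟩
    sum (λ y → 2 * K * χ (Good T y) + χ (T y) * outDeg T y)
      ≡⟨ ∑-distrib-+ (λ y → 2 * K * χ (Good T y)) (λ y → χ (T y) * outDeg T y) ⟩
    sum (λ y → 2 * K * χ (Good T y)) + boundary T
      ≡⟨ cong (_+ boundary T) (*-distribˡ-sum (2 * K) (χ ∘ Good T)) ⟨
    2 * K * count (Good T) + boundary T ∎
    where
    open ≤-Reasoning
    pointwise : ∀ y → 2 * K * χ ((B ∩ T) y) ≤ 2 * K * χ (Good T y) + χ (T y) * outDeg T y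
    pointwise y with B y | T y | degree y ≤ᵇ inDeg T y + 2 * K in good?
    ... | false | _     | _     = ≤-trans (≤-reflexive (*-zeroʳ (2 * K))) z≤n
    ... | true  | false | _     = ≤-trans (≤-reflexive (*-zeroʳ (2 * K))) z≤n
    ... | true  | true  | true  = m≤m+n _ _
    ... | true  | true  | false = begin
      2 * K * 1                  ≡⟨ *-identityʳ (2 * K) ⟩
      2 * K                      ≤⟨ <⇒≤ (bad⇒2K<outDeg T y good?) ⟩
      outDeg T y                 ≡⟨ *-identityˡ (outDeg T y) ⟨
      1 * outDeg T y             ≡⟨ cong (_+ 1 * outDeg T y) (*-zeroʳ (2 * K)) ⟨
      2 * K * 0 + 1 * outDeg T y ∎

  count≤2D*Good : ∀ {T} → Candidate T → count T ≤ 2 * D * count (Good T)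
  count≤2D*Good {T} T-candidate = *-cancelˡ-≤ (2 * K) {{>-nonZero (≤-trans 1≤K K≤2K)}}
    (+-cancelʳ-≤ (K * c) _ _ (+-cancelʳ-≤ (2 * D * b) _ _ (begin
      2 * K * c + K * c + 2 * D * b            ≡⟨ e₁ K c (2 * D * b) ⟩
      pot⁻ T                                   ≤⟨ admissible ⟩
      4 * D * K * cb + C                       ≡⟨ cong (_+ C) (e₂ D K cb) ⟩
      2 * D * (2 * K * cb) + C                 ≤⟨ +-mono-≤ (*-monoʳ-≤ (2 * D) (B∩-good-or-boundary T)) C≤Kc ⟩
      2 * D * (2 * K * g + b) + K * c          ≡⟨ e₃ D K g b (K * c) ⟩
      2 * K * (2 * D * g) + K * c + 2 * D * b  ∎)))
    where
    open ≤-Reasoning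
    open Candidate T-candidate
    c g cb b : ℕ
    c = count T
    g = count (Good T)
    cb = count (B ∩ T)
    b = boundary T
    1≤K : 1 ≤ K
    1≤K = ≤-trans 1≤k k≤K
    C≤Kc : C ≤ K * c
    C≤Kc = ≤-trans (<⇒≤ C<N₀) (≤-trans (N₀≤count thick vertex∈S)
             (≤-trans (≤-reflexive (sym (*-identityˡ c))) (*-monoˡ-≤ c 1≤K)))
    e₁ : ∀ K c y → 2 * K * c + K * c + y ≡ 3 * K * c + y
    e₁ = solve-∀
    e₂ : ∀ D K cb → 4 * D * K * cb ≡ 2 * D * (2 * K * cb)
    e₂ = solve-∀
    e₃ : ∀ D K g b z → 2 * D * (2 * K * g + b) + z ≡ 2 * K * (2 * D * g) + z + 2 * D * b
    e₃ = solve-∀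

  11KD≤2*Good : ∀ {T} → Candidate T → 11 * K * D ≤ 2 * count (Good T)
  11KD≤2*Good {T} T-candidate = *-cancelˡ-≤ D {{>-nonZero 1≤D}} (begin
    D * (11 * K * D)           ≡⟨ e₁ K D ⟩
    N₀                         ≤⟨ N₀≤count thick vertex∈S ⟩
    count T                    ≤⟨ count≤2D*Good T-candidate ⟩
    2 * D * count (Good T)     ≡⟨ *-assoc 2 D (count (Good T)) ⟩
    2 * (D * count (Good T))   ≡⟨ *-comm 2 (D * count (Good T)) ⟩
    D * count (Good T) * 2     ≡⟨ *-assoc D (count (Good T)) 2 ⟩
    D * (count (Good T) * 2)   ≡⟨ cong (D *_) (*-comm (count (Good T)) 2) ⟩
    D * (2 * count (Good T))   ∎)
    where
    open ≤-Reasoning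
    open Candidate T-candidate
    e₁ : ∀ K D → D * (11 * K * D) ≡ 11 * K * (D * D)
    e₁ = solve-∀

lemma4p1 : (k D m n : ℕ) → 2 ≤ k → 1 ≤ D → 1 ≤ m → 1 ≤ n →
    (G : Graph n) →
    MinDeg≥ G (9 * (k * k)) → MaxDeg≤ G D → Girth≥ G (2 * m + 2) →
    (B : Subset n) → n ≤ D * ∣ B ∣ →
    11 * (k * k) * (D * D) ≤ 2 * (k * k ∸ 1) ^ m →
    Σ (Subset n) λ S →
      KConnected G k S
      × 11 * (k * k) * (D * D) ≤ ∣ S ∣
      × ∣ S ∣ ≤ 2 * D * ∣ GoodSet G B S (2 * (k * k)) ∣
      × 11 * (k * k) * D ≤ 2 * ∣ GoodSet G B S (2 * (k * k)) ∣
lemma4p1 k D m (suc n) 2≤k 1≤D 1≤m _ G δ≥9k² Δ≤D girth B n≤D∣B∣ moore =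
  tabulate T , k-connected , large , dense , dense′
  where
  open Construction G k D m (lookup B) zero 2≤k 1≤D 1≤m δ≥9k² Δ≤D girth moore
  found : KConnectedCandidate
  found = KConnected-Candidate (full-Candidate (subst (λ b → suc n ≤ D * b) (∣∣≡count B) n≤D∣B∣))
  T : BSet (suc n)
  T = proj₁ found
  T-candidate : Candidate T
  T-candidate = proj₁ (proj₂ found)
  k-connected : KConnected G k (tabulate T)
  k-connected = proj₂ (proj₂ found)
  open Candidate T-candidate
  ∣Good∣ : ∣ GoodSet G B (tabulate T) (2 * K) ∣ ≡ count (Good T)
  ∣Good∣ = ∣GoodSet∣≡count G B T (2 * K)
  large : N₀ ≤ ∣ tabulate T ∣
  large = subst (N₀ ≤_) (sym (∣tabulate∣≡count T)) (N₀≤count thick vertex∈S)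
  dense : ∣ tabulate T ∣ ≤ 2 * D * ∣ GoodSet G B (tabulate T) (2 * K) ∣
  dense = subst₂ (λ t g → t ≤ 2 * D * g) (sym (∣tabulate∣≡count T)) (sym ∣Good∣) (count≤2D*Good T-candidate)
  dense′ : 11 * K * D ≤ 2 * ∣ GoodSet G B (tabulate T) (2 * K) ∣
  dense′ = subst (λ g → 11 * K * D ≤ 2 * g) (sym ∣Good∣) (11KD≤2*Good T-candidate)
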